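{- Let $n\geq 5$ and let $j,k$ be integers with $0\leq k\leq \lceil\frac{n-2}{2}\rceil$. Then the number of spanning trees of the strip graph with tails $S_{n,k,j}$ equals the number of spanning trees of the strip graph $S_{n-2k}$, i.e. $t(S_{n,k,j})=t(S_{n-2k})$.
   Context: For $n\geq 5$, the square cycle $C_n^2$ has vertex set $\mathbb{Z}_n=\mathbb{Z}/n\mathbb{Z}$, with $v_i=i+n\mathbb{Z}$ for $i\in\mathbb{Z}$, and edge set $\{\{v_i,v_j\}: i-j\in\{1,2\}\}$. For $i\in\mathbb{Z}$ write $e_i=\{v_i,v_{i+1}\}$ (frames) and $f_i=\{v_i,v_{i+2}\}$ (windows); indices are taken modulo $n$. For integers $j,k$ with $0\leq k\leq\lceil\frac{n-2}{2}\rceil$, the escape route is $ES(n,k,j)=\{f_j,f_{j+2k+1}\}\cup\{e_{j+1},e_{j+2},\dots,e_{j+2k+1}\}$, and the strip graph with tails $S_{n,k,j}$ is the graph with vertex set $\mathbb{Z}_n$ and edge set $E(C_n^2)\setminus ES(n,k,j)$. For $m\geq 1$, the strip graph $S_m$ has vertex set $\{1,\dots,m\}$ and edges $\{i,j\}$ with $1\leq|i-j|\leq 2$. For a connected graph $G$, $t(G)$ denotes its number of spanning trees. -}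

module Defs where

open import Data.Nat using (ℕ; zero; suc; _≤_; _∸_; ⌈_/2⌉; NonZero) renaming (_+_ to _+ℕ_; _*_ to _*ℕ_)
open import Data.Integer using (ℤ; +_; _+_; _%ℕ_)
open import Data.Fin using (Fin; toℕ)
open import Data.Bool using (Bool; true; false)
open import Data.Vec using (Vec; lookup)
open import Data.List using (List; []; _∷_; _++_; length)
open import Data.List.Relation.Unary.Unique.Propositional using (Unique)
open import Data.List.Membership.Propositional using (_∈_)
open import Data.Product using (Σ; _×_; ∃)
open import Data.Sum using (_⊎_)
open import Data.Unit using (⊤)
open import Relation.Nullary using (¬_)
open import Relation.Binary.PropositionalEquality using (_≡_)

Graph : ℕ → Set₁
Graph n = Fin n → Fin n → Set

-- A spanning subgraph (candidate tree) given by its adjacency matrix.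
Matrix : ℕ → Set
Matrix n = Vec (Vec Bool n) n

_⟨_,_⟩ : ∀ {n} → Matrix n → Fin n → Fin n → Bool
T ⟨ a , b ⟩ = lookup (lookup T a) b

data Walk {n} (T : Matrix n) : Fin n → Fin n → Set where
  here : ∀ {u} → Walk T u u
  step : ∀ {u w v} → T ⟨ u , w ⟩ ≡ true → Walk T w v → Walk T u v

Chain : ∀ {n} → Matrix n → List (Fin n) → Set
Chain T (x ∷ y ∷ rest) = (T ⟨ x , y ⟩ ≡ true) × Chain T (y ∷ rest)
Chain T _ = ⊤

HasCycle : ∀ {n} → Matrix n → Set
HasCycle {n} T = Σ (Fin n) λ v → Σ (List (Fin n)) λ ws →
  (3 ≤ length (v ∷ ws)) × Unique (v ∷ ws) × Chain T ((v ∷ ws) ++ (v ∷ []))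

IsSpanningTree : ∀ {n} → Graph n → Matrix n → Set
IsSpanningTree {n} G T =
  (∀ a b → T ⟨ a , b ⟩ ≡ T ⟨ b , a ⟩) ×
  (∀ a → T ⟨ a , a ⟩ ≡ false) ×
  (∀ a b → T ⟨ a , b ⟩ ≡ true → G a b) ×
  (∀ u v → Walk T u v) ×
  ¬ HasCycle T

NumSpanningTrees : ∀ {n} → Graph n → ℕ → Set
NumSpanningTrees {n} G c = Σ (List (Matrix n)) λ L →
  Unique L ×
  (∀ T → T ∈ L → IsSpanningTree G T) ×
  (∀ T → IsSpanningTree G T → T ∈ L) ×
  length L ≡ c

-- Square cycle C_n^2 on Z_n, vertex v_i (i ∈ ℤ) is Fin n element i mod n.

module _ (n : ℕ) .{{_ : NonZero n}} where

  PairEdge : ℤ → ℤ → Graph n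
  PairEdge x y a b =
    (toℕ a ≡ x %ℕ n × toℕ b ≡ y %ℕ n) ⊎ (toℕ a ≡ y %ℕ n × toℕ b ≡ x %ℕ n)

  Frame : ℤ → Graph n
  Frame i = PairEdge i (i + + 1)

  Window : ℤ → Graph n
  Window i = PairEdge i (i + + 2)

  SqCycle : Graph n
  SqCycle a b = ∃ λ (i : ℤ) → Frame i a b ⊎ Window i a b

  EscapeRoute : ℕ → ℤ → Graph n
  EscapeRoute k j a b =
    Window j a b ⊎ Window (j + + (2 *ℕ k +ℕ 1)) a b ⊎
    (Σ ℕ λ t → (1 ≤ t) × (t ≤ 2 *ℕ k +ℕ 1) × Frame (j + + t) a b)

  StripTails : ℕ → ℤ → Graph n
  StripTails k j a b = SqCycle a b × ¬ EscapeRoute k j a b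

-- strip graph S_m on {1..m} (vertex i+1 represented by i : Fin m):
-- edges {a,b} with 1 ≤ |a-b| ≤ 2
Strip : (m : ℕ) → Graph m
Strip m a b = (toℕ b ≡ toℕ a +ℕ 1) ⊎ (toℕ b ≡ toℕ a +ℕ 2) ⊎
              (toℕ a ≡ toℕ b +ℕ 1) ⊎ (toℕ a ≡ toℕ b +ℕ 2)

-- Number the vertices by position: v_i sits at i − j − 2 (mod n). The escape route then
-- consists of the frames starting at n − 1, 0, …, 2k − 1 and the windows starting at n − 2
-- and 2k − 1, so S_{n,k,j} is the strip S_{n−2k} on the positions 2k, …, n − 1 with two
-- paths of windows hanging off it: 0, 2, …, 2k ending in the strip at 2k, and
-- 1, 3, …, 2k − 1 joined to n − 1 by f_{j+1}. Hence S_{n,k,j} arises from S_{n−2k} by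
-- attaching 2k leaves one after another, and attaching a leaf u′ to u is a bijection on
-- spanning trees (the only tree edge at u′ is {u, u′}).

module Submission where

open import Defs
open import Data.Bool using (Bool; true; false)
import Data.Bool as Bool
import Data.Bool.Properties as Boolₚ
open import Data.Empty using (⊥; ⊥-elim)
open import Data.Fin using (Fin; zero; suc; toℕ; fromℕ<)
open import Data.Fin.Properties using (toℕ-fromℕ<; toℕ<n; toℕ-injective)
import Data.Fin.Properties as Finₚ
open import Data.Integer as ℤ using (ℤ; +_; -[1+_]; _%ℕ_; _/ℕ_)
import Data.Integer.Properties as ℤₚ
open import Data.Integer.DivMod using (a≡a%ℕn+[a/ℕn]*n; n%ℕd<d)
open import Data.Integer.Solver using () renaming (module +-*-Solver to ℤSolver)
open import Data.List as List using (List; []; _∷_; _++_; length; map; concatMap; allFin; filter; deduplicate)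
open import Data.List.Properties using (length-map; map-++; ++-assoc; length-++)
open import Data.List.Membership.Propositional using (_∈_; _∉_; lose)
open import Data.List.Membership.Propositional.Properties
  using (∈-map⁺; ∈-map⁻; ∈-∃++; ∈-lookup; ∈-allFin; ∈-concatMap⁺; ∈-filter⁺; ∈-filter⁻; ∈-deduplicate⁺; ∈-deduplicate⁻)
import Data.List.Membership.DecPropositional as DecMembership
open import Data.List.Relation.Unary.All as All using (All; []; _∷_)
open import Data.List.Relation.Unary.All.Properties using (¬Any⇒All¬)
import Data.List.Relation.Unary.All.Properties as Allₚ
open import Data.List.Relation.Unary.Any as Any using (Any; here; there)
open import Data.List.Relation.Unary.Unique.Propositional using (Unique; []; _∷_)
import Data.List.Relation.Unary.Unique.Propositional.Properties as Uniqueₚ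
import Data.List.Relation.Unary.Unique.DecPropositional as DecUnique
import Data.List.Relation.Unary.Unique.DecPropositional.Properties as DecUniqueₚ
import Data.List.Relation.Binary.Permutation.Setoid.Properties as Permₚ
open import Data.Nat as ℕ using (ℕ; zero; suc; NonZero; _+_; _*_; _∸_; _%_; _≤_; _<_; z≤n; s≤s; z<s; _≤?_; _<?_; ⌈_/2⌉; parity)
open import Data.Nat.Properties
open import Data.Nat.DivMod using (m<n⇒m%n≡m; m%n<n; [m+n]%n≡m%n; %-distribˡ-+; m%n%n≡m%n; n%n≡0)
open import Data.Parity.Base as ℙ using (0ℙ; 1ℙ)
import Data.Parity.Properties as ℙₚ
open import Data.Product using (Σ; _×_; _,_; proj₁; proj₂)
open import Data.Sum using (_⊎_; inj₁; inj₂)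
open import Data.Unit using (tt)
open import Data.Vec as Vec using (Vec; lookup; tabulate)
open import Data.Vec.Properties using (lookup∘tabulate; tabulate∘lookup; tabulate-cong)
import Data.Vec.Properties as Vecₚ
open import Function using (_∘′_)
open import Function.Definitions using (Injective)
open import Relation.Nullary using (¬_; Dec; yes; no; does; ¬?)
open import Relation.Nullary.Decidable using (_×-dec_; _→-dec_; _⊎-dec_; map′; dec-true)
open import Relation.Binary.Definitions using (DecidableEquality)
open import Relation.Binary.PropositionalEquality

tabulateᴹ : ∀ {n} → (Fin n → Fin n → Bool) → Matrix n
tabulateᴹ f = tabulate λ a → tabulate (f a)

lookup-tabulateᴹ : ∀ {n} (f : Fin n → Fin n → Bool) a b → tabulateᴹ f ⟨ a , b ⟩ ≡ f a b
lookup-tabulateᴹ f a b rewrite lookup∘tabulate (λ a → tabulate (f a)) a = lookup∘tabulate (f a) b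

matrix-ext : ∀ {n} {T S : Matrix n} → (∀ a b → T ⟨ a , b ⟩ ≡ S ⟨ a , b ⟩) → T ≡ S
matrix-ext {T = T} {S} T≗S = begin
  T                   ≡⟨ sym (tabulate∘lookup T) ⟩
  tabulate (lookup T) ≡⟨ tabulate-cong row ⟩
  tabulate (lookup S) ≡⟨ tabulate∘lookup S ⟩
  S                   ∎
  where
  open ≡-Reasoning
  row : ∀ a → lookup T a ≡ lookup S a
  row a = trans (sym (tabulate∘lookup (lookup T a)))
                (trans (tabulate-cong (T≗S a)) (tabulate∘lookup (lookup S a)))

EdgeMorphism : ∀ {n n′} → Matrix n → Matrix n′ → (Fin n → Fin n′) → Set
EdgeMorphism T S h = ∀ a b → T ⟨ a , b ⟩ ≡ true → S ⟨ h a , h b ⟩ ≡ true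

module _ {n n′} {T : Matrix n} {S : Matrix n′} (h : Fin n → Fin n′) where

  walk-map : EdgeMorphism T S h → ∀ {a b} → Walk T a b → Walk S (h a) (h b)
  walk-map hom here = here
  walk-map hom (step {u} {w} e p) = step (hom u w e) (walk-map hom p)

  chain-map : EdgeMorphism T S h → ∀ xs → Chain T xs → Chain S (map h xs)
  chain-map hom []          _       = tt
  chain-map hom (x ∷ [])    _       = tt
  chain-map hom (x ∷ y ∷ r) (e , c) = hom x y e , chain-map hom (y ∷ r) c

  chain-reflect : (∀ a b → S ⟨ h a , h b ⟩ ≡ true → T ⟨ a , b ⟩ ≡ true) →
                  ∀ xs → Chain S (map h xs) → Chain T xs
  chain-reflect reflects []          _       = tt
  chain-reflect reflects (x ∷ [])    _       = tt
  chain-reflect reflects (x ∷ y ∷ r) (e , c) = reflects x y e , chain-reflect reflects (y ∷ r) c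

  hasCycle-map : Injective _≡_ _≡_ h → EdgeMorphism T S h → HasCycle T → HasCycle S
  hasCycle-map inj hom (v , ws , len , u , ch) =
    h v , map h ws ,
    subst (λ l → 3 ≤ suc l) (sym (length-map h ws)) len ,
    Uniqueₚ.map⁺ inj u ,
    subst (Chain S) (map-++ h (v ∷ ws) (v ∷ [])) (chain-map hom ((v ∷ ws) ++ (v ∷ [])) ch)

walk-++ : ∀ {n} {T : Matrix n} {a b c} → Walk T a b → Walk T b c → Walk T a c
walk-++ here       q = q
walk-++ (step e p) q = step e (walk-++ p q)

module _ {n} {T : Matrix n} where

  chain-split : ∀ xs y ys → Chain T (xs ++ y ∷ ys) → Chain T (xs ++ y ∷ []) × Chain T (y ∷ ys)
  chain-split []            y ys c       = tt , c
  chain-split (x ∷ [])      y ys (e , c) = (e , tt) , c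
  chain-split (x ∷ x′ ∷ xs) y ys (e , c) =
    let c₁ , c₂ = chain-split (x′ ∷ xs) y ys c in (e , c₁) , c₂

  chain-join : ∀ xs y ys → Chain T (xs ++ y ∷ []) → Chain T (y ∷ ys) → Chain T (xs ++ y ∷ ys)
  chain-join []            y ys c₁       c₂ = c₂
  chain-join (x ∷ [])      y ys (e , _)  c₂ = e , c₂
  chain-join (x ∷ x′ ∷ xs) y ys (e , c₁) c₂ = e , chain-join (x′ ∷ xs) y ys c₁ c₂

  chain-last : ∀ z z′ zs y → Chain T (z ∷ z′ ∷ zs ++ y ∷ []) →
               Σ (Fin n) λ w → w ∈ (z′ ∷ zs) × T ⟨ w , y ⟩ ≡ true
  chain-last z z′ []        y (_ , e , _) = z′ , here refl , e
  chain-last z z′ (z″ ∷ zs) y (_ , c)     =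
    let w , w∈ , e = chain-last z′ z″ zs y c in w , there w∈ , e

  Cycle : Fin n → List (Fin n) → Set
  Cycle v ws = 3 ≤ length (v ∷ ws) × Unique (v ∷ ws) × Chain T ((v ∷ ws) ++ (v ∷ []))

  cycle-rotate : ∀ {v ws x} → x ∈ (v ∷ ws) → Cycle v ws → Σ (List (Fin n)) (Cycle x)
  cycle-rotate {v} {ws} {x} x∈ (len , u , ch) with ∈-∃++ x∈
  ... | []     , zs , refl = zs , len , u , ch
  ... | _ ∷ p , q  , refl =
    q ++ v ∷ p ,
    subst (3 ≤_) (length-swap (v ∷ p) (x ∷ q)) len ,
    Permₚ.Unique-resp-↭ (setoid (Fin n)) (Permₚ.++-comm (setoid (Fin n)) (v ∷ p) (x ∷ q)) u ,
    subst (Chain T) (sym (++-assoc (x ∷ q) (v ∷ p) (x ∷ [])))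
          (chain-join (x ∷ q) v (p ++ x ∷ []) (proj₂ halves) (proj₁ halves))
    where
    length-swap : ∀ (as bs : List (Fin n)) → length (as ++ bs) ≡ length (bs ++ as)
    length-swap as bs = trans (length-++ as) (trans (+-comm (length as) _) (sym (length-++ bs)))
    halves : Chain T ((v ∷ p) ++ x ∷ []) × Chain T (x ∷ q ++ v ∷ [])
    halves = chain-split (v ∷ p) x (q ++ v ∷ []) (subst (Chain T) (++-assoc (v ∷ p) (x ∷ q) (v ∷ [])) ch)

-- Invariance of the number of spanning trees

unique-map⁺ : ∀ {A B : Set} (f : A → B) {xs : List A} →
              (∀ {x y} → x ∈ xs → y ∈ xs → f x ≡ f y → x ≡ y) → Unique xs → Unique (map f xs)
unique-map⁺ f {[]}     inj []         = []
unique-map⁺ f {x ∷ xs} inj (x∉ ∷ u) =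
  Allₚ.map⁺ (All.tabulate λ y∈ fx≡fy → All.lookup x∉ y∈ (inj (here refl) (there y∈) fx≡fy))
  ∷ unique-map⁺ f (λ p q → inj (there p) (there q)) u

numSpanningTrees-bijection :
  ∀ {n n′} {G : Graph n} {G′ : Graph n′} {c} (f : Matrix n → Matrix n′) (g : Matrix n′ → Matrix n) →
  (∀ T → IsSpanningTree G T → IsSpanningTree G′ (f T)) →
  (∀ T → IsSpanningTree G′ T → IsSpanningTree G (g T)) →
  (∀ T → IsSpanningTree G T → g (f T) ≡ T) →
  (∀ T → IsSpanningTree G′ T → f (g T) ≡ T) →
  NumSpanningTrees G c → NumSpanningTrees G′ c
numSpanningTrees-bijection {G = G} {G′} f g f-tree g-tree gf fg (Ts , u , sound , complete , len) =
  map f Ts , unique-map⁺ f inj u , sound′ , complete′ , trans (length-map f Ts) len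
  where
  inj : ∀ {x y} → x ∈ Ts → y ∈ Ts → f x ≡ f y → x ≡ y
  inj {x} {y} x∈ y∈ e = trans (sym (gf x (sound x x∈))) (trans (cong g e) (gf y (sound y y∈)))
  sound′ : ∀ T → T ∈ map f Ts → IsSpanningTree G′ T
  sound′ T T∈ with ∈-map⁻ f T∈
  ... | S , S∈ , refl = f-tree S (sound S S∈)
  complete′ : ∀ T → IsSpanningTree G′ T → T ∈ map f Ts
  complete′ T t = subst (_∈ map f Ts) (fg T t) (∈-map⁺ f (complete (g T) (g-tree T t)))

spanningTree-irreflexive : ∀ {n} {G : Graph n} {T} → IsSpanningTree G T →
                           ∀ {a b} → T ⟨ a , b ⟩ ≡ true → a ≢ b
spanningTree-irreflexive (_ , loopless , _) {a} e refl with trans (sym e) (loopless a)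
... | ()

-- Spanning trees never use loops, so only the off-diagonal part of a graph matters.
numSpanningTrees-cong : ∀ {n} {G G′ : Graph n} {c} →
  (∀ a b → a ≢ b → G a b → G′ a b) → (∀ a b → a ≢ b → G′ a b → G a b) →
  NumSpanningTrees G c → NumSpanningTrees G′ c
numSpanningTrees-cong G⊆G′ G′⊆G =
  numSpanningTrees-bijection (λ T → T) (λ T → T) (retarget G⊆G′) (retarget G′⊆G) (λ _ _ → refl) (λ _ _ → refl)
  where
  retarget : ∀ {H H′ : Graph _} → (∀ a b → a ≢ b → H a b → H′ a b) →
             ∀ T → IsSpanningTree H T → IsSpanningTree H′ T
  retarget H⊆H′ T t@(sym′ , loopless , inH , conn , acyc) =
    sym′ , loopless , (λ a b e → H⊆H′ a b (spanningTree-irreflexive t e) (inH a b e)) , conn , acyc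

relabelᴹ : ∀ {n n′} → (Fin n′ → Fin n) → Matrix n → Matrix n′
relabelᴹ σ T = tabulateᴹ λ x y → T ⟨ σ x , σ y ⟩

module _ {n n′} (σ : Fin n′ → Fin n) (ρ : Fin n → Fin n′)
         (ρσ : ∀ x → ρ (σ x) ≡ x) (σρ : ∀ a → σ (ρ a) ≡ a) where

  relabelᴹ-inverse : ∀ T → relabelᴹ ρ (relabelᴹ σ T) ≡ T
  relabelᴹ-inverse T = matrix-ext λ a b →
    trans (lookup-tabulateᴹ _ a b)
          (trans (lookup-tabulateᴹ _ (ρ a) (ρ b)) (cong₂ (λ x y → T ⟨ x , y ⟩) (σρ a) (σρ b)))

  isSpanningTree-relabel : {G : Graph n} {H : Graph n′} → (∀ x y → x ≢ y → G (σ x) (σ y) → H x y) →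
                           ∀ T → IsSpanningTree G T → IsSpanningTree H (relabelᴹ σ T)
  isSpanningTree-relabel {G} {H} G⇒H T t@(sym′ , loopless , inG , conn , acyc) =
    (λ a b → trans (lk a b) (trans (sym′ (σ a) (σ b)) (sym (lk b a)))) ,
    (λ a → trans (lk a a) (loopless (σ a))) ,
    (λ a b e → let e′ = trans (sym (lk a b)) e in
               G⇒H a b (λ a≡b → spanningTree-irreflexive t e′ (cong σ a≡b)) (inG (σ a) (σ b) e′)) ,
    (λ x y → subst₂ (Walk _) (ρσ x) (ρσ y) (walk-map ρ ρ-hom (conn (σ x) (σ y)))) ,
    λ cyc → acyc (hasCycle-map σ σ-injective (λ a b e → trans (sym (lk a b)) e) cyc)
    where
    lk : ∀ a b → relabelᴹ σ T ⟨ a , b ⟩ ≡ T ⟨ σ a , σ b ⟩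
    lk = lookup-tabulateᴹ _
    σ-injective : Injective _≡_ _≡_ σ
    σ-injective {x} {y} e = trans (sym (ρσ x)) (trans (cong ρ e) (ρσ y))
    ρ-hom : EdgeMorphism T (relabelᴹ σ T) ρ
    ρ-hom a b e = trans (lk (ρ a) (ρ b)) (trans (cong₂ (λ x y → T ⟨ x , y ⟩) (σρ a) (σρ b)) e)

numSpanningTrees-relabel : ∀ {n n′} (σ : Fin n′ → Fin n) (ρ : Fin n → Fin n′) →
  (∀ x → ρ (σ x) ≡ x) → (∀ a → σ (ρ a) ≡ a) →
  {G : Graph n} {H : Graph n′} → (∀ x y → x ≢ y → G (σ x) (σ y) → H x y) →
  (∀ x y → x ≢ y → H x y → G (σ x) (σ y)) → ∀ {c} →
  NumSpanningTrees G c → NumSpanningTrees H c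
numSpanningTrees-relabel σ ρ ρσ σρ {G} {H} G⇒H H⇒G =
  numSpanningTrees-bijection (relabelᴹ σ) (relabelᴹ ρ)
    (isSpanningTree-relabel σ ρ ρσ σρ G⇒H) (isSpanningTree-relabel ρ σ σρ ρσ H⇒G′)
    (λ T _ → relabelᴹ-inverse σ ρ ρσ σρ T) (λ T _ → relabelᴹ-inverse ρ σ σρ ρσ T)
  where
  H⇒G′ : ∀ a b → a ≢ b → H (ρ a) (ρ b) → G a b
  H⇒G′ a b a≢b h = subst₂ G (σρ a) (σρ b)
    (H⇒G (ρ a) (ρ b) (λ e → a≢b (trans (sym (σρ a)) (trans (cong σ e) (σρ b)))) h)

-- Attaching a leaf

AddLeaf : ∀ {n} → Graph n → Fin n → Graph (suc n)
AddLeaf G u zero    zero    = ⊥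
AddLeaf G u zero    (suc b) = b ≡ u
AddLeaf G u (suc a) zero    = a ≡ u
AddLeaf G u (suc a) (suc b) = G a b

witness : ∀ {A : Set} (a? : Dec A) → does a? ≡ true → A
witness (yes a) _ = a

map-suc⁻ : ∀ {n} (xs : List (Fin (suc n))) → zero ∉ xs → Σ (List (Fin n)) λ ys → map suc ys ≡ xs
map-suc⁻ []           _   = [] , refl
map-suc⁻ (zero ∷ xs)  z∉  = ⊥-elim (z∉ (here refl))
map-suc⁻ (suc x ∷ xs) z∉ =
  let ys , e = map-suc⁻ xs (z∉ ∘′ there) in x ∷ ys , cong (suc x ∷_) e

module _ {n} (G : Graph n) (u : Fin n) where

  attachLeafᴮ : Matrix n → Fin (suc n) → Fin (suc n) → Bool
  attachLeafᴮ S zero    zero    = false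
  attachLeafᴮ S zero    (suc b) = does (b Finₚ.≟ u)
  attachLeafᴮ S (suc a) zero    = does (a Finₚ.≟ u)
  attachLeafᴮ S (suc a) (suc b) = S ⟨ a , b ⟩

  attachLeaf : Matrix n → Matrix (suc n)
  attachLeaf S = tabulateᴹ (attachLeafᴮ S)

  detachLeaf : Matrix (suc n) → Matrix n
  detachLeaf T = tabulateᴹ λ a b → T ⟨ suc a , suc b ⟩

  isSpanningTree-attachLeaf : ∀ S → IsSpanningTree G S → IsSpanningTree (AddLeaf G u) (attachLeaf S)
  isSpanningTree-attachLeaf S (sym′ , loopless , inG , conn , acyc) =
    symmetric , irreflexive , edges , connected , acyclic
    where
    E : Matrix (suc n)
    E = attachLeaf S
    lk : ∀ a b → E ⟨ a , b ⟩ ≡ attachLeafᴮ S a b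
    lk = lookup-tabulateᴹ (attachLeafᴮ S)

    symmetric : ∀ a b → E ⟨ a , b ⟩ ≡ E ⟨ b , a ⟩
    symmetric a b = trans (lk a b) (trans (symᴮ a b) (sym (lk b a)))
      where
      symᴮ : ∀ a b → attachLeafᴮ S a b ≡ attachLeafᴮ S b a
      symᴮ zero    zero    = refl
      symᴮ zero    (suc b) = refl
      symᴮ (suc a) zero    = refl
      symᴮ (suc a) (suc b) = sym′ a b

    irreflexive : ∀ a → E ⟨ a , a ⟩ ≡ false
    irreflexive zero    = lk zero zero
    irreflexive (suc a) = trans (lk (suc a) (suc a)) (loopless a)

    edges : ∀ a b → E ⟨ a , b ⟩ ≡ true → AddLeaf G u a b
    edges a b e = edgesᴮ a b (trans (sym (lk a b)) e)
      where
      edgesᴮ : ∀ a b → attachLeafᴮ S a b ≡ true → AddLeaf G u a b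
      edgesᴮ zero    (suc b) e = witness (b Finₚ.≟ u) e
      edgesᴮ (suc a) zero    e = witness (a Finₚ.≟ u) e
      edgesᴮ (suc a) (suc b) e = inG a b e

    suc-hom : EdgeMorphism S E suc
    suc-hom a b e = trans (lk (suc a) (suc b)) e
    leaf→u : E ⟨ zero , suc u ⟩ ≡ true
    leaf→u = trans (lk zero (suc u)) (dec-true (u Finₚ.≟ u) refl)
    u→leaf : E ⟨ suc u , zero ⟩ ≡ true
    u→leaf = trans (lk (suc u) zero) (dec-true (u Finₚ.≟ u) refl)

    connected : ∀ a b → Walk E a b
    connected zero    zero    = here
    connected zero    (suc b) = step leaf→u (walk-map suc suc-hom (conn u b))
    connected (suc a) zero    = walk-++ (walk-map suc suc-hom (conn a u)) (step u→leaf here)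
    connected (suc a) (suc b) = walk-map suc suc-hom (conn a b)

    only-neighbour : ∀ w → E ⟨ zero , w ⟩ ≡ true → w ≡ suc u
    only-neighbour zero    e = ⊥-elim (edges zero zero e)
    only-neighbour (suc w) e = cong suc (edges zero (suc w) e)

    avoiding-leaf : ∀ v ws → zero ∉ (v ∷ ws) → ¬ Cycle {T = E} v ws
    avoiding-leaf v ws z∉ with map-suc⁻ (v ∷ ws) z∉
    ... | y ∷ ys , refl = λ (len , uniq , ch) →
      acyc (y , ys , subst (λ l → 3 ≤ suc l) (length-map suc ys) len , Uniqueₚ.map⁻ uniq ,
            chain-reflect suc (λ a b e → trans (sym (lk (suc a) (suc b))) e) ((y ∷ ys) ++ y ∷ [])
              (subst (Chain E) (sym (map-++ suc (y ∷ ys) (y ∷ []))) ch))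

    -- the leaf would need two distinct neighbours on the cycle
    through-leaf : ∀ ws → ¬ Cycle {T = E} zero ws
    through-leaf (_ ∷ []) (s≤s (s≤s ()) , _)
    through-leaf (w₁ ∷ w₂ ∷ ws) (_ , _ ∷ (w₁∉ ∷ _) , e₀₁ , ch)
      with chain-last w₁ w₂ ws zero ch
    ... | w , w∈ , e = All.lookup w₁∉ w∈
      (trans (only-neighbour w₁ e₀₁) (sym (only-neighbour w (trans (symmetric zero w) e))))

    acyclic : ¬ HasCycle E
    acyclic (v , ws , cyc) with DecMembership._∈?_ Finₚ._≟_ zero (v ∷ ws)
    ... | no  z∉ = avoiding-leaf v ws z∉ cyc
    ... | yes z∈ = let ws′ , cyc′ = cycle-rotate z∈ cyc in through-leaf ws′ cyc′

  isSpanningTree-detachLeaf : ∀ T → IsSpanningTree (AddLeaf G u) T → IsSpanningTree G (detachLeaf T)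
  isSpanningTree-detachLeaf T (sym′ , loopless , inG , conn , acyc) =
    (λ a b → trans (lk a b) (trans (sym′ (suc a) (suc b)) (sym (lk b a)))) ,
    (λ a → trans (lk a a) (loopless (suc a))) ,
    (λ a b e → inG (suc a) (suc b) (trans (sym (lk a b)) e)) ,
    (λ a b → shortcut (conn (suc a) (suc b))) ,
    λ cyc → acyc (hasCycle-map suc Finₚ.suc-injective (λ a b e → trans (sym (lk a b)) e) cyc)
    where
    R : Matrix n
    R = detachLeaf T
    lk : ∀ a b → R ⟨ a , b ⟩ ≡ T ⟨ suc a , suc b ⟩
    lk = lookup-tabulateᴹ _
    -- a detour through the leaf returns to the vertex it left from
    shortcut : ∀ {a b} → Walk T (suc a) (suc b) → Walk R a b
    shortcut here = here
    shortcut (step {w = suc w} e p) = step (trans (lk _ w) e) (shortcut p)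
    shortcut (step {w = zero} e (step {w = zero} e′ p)) = ⊥-elim (inG zero zero e′)
    shortcut {a} {b} (step {w = zero} e (step {w = suc c} e′ p)) =
      subst (λ z → Walk R z b) (trans (inG zero (suc c) e′) (sym (inG (suc a) zero e))) (shortcut p)

  detach-attach : ∀ S → detachLeaf (attachLeaf S) ≡ S
  detach-attach S = matrix-ext λ a b → trans (lookup-tabulateᴹ _ a b) (lookup-tabulateᴹ (attachLeafᴮ S) (suc a) (suc b))

  attach-detach : ∀ T → IsSpanningTree (AddLeaf G u) T → attachLeaf (detachLeaf T) ≡ T
  attach-detach T (sym′ , loopless , inG , conn , _) =
    matrix-ext λ a b → trans (lookup-tabulateᴹ (attachLeafᴮ (detachLeaf T)) a b) (agree a b)
    where
    leaf-row : ∀ b → does (b Finₚ.≟ u) ≡ T ⟨ zero , suc b ⟩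
    leaf-row b with b Finₚ.≟ u
    ... | no b≢u = sym (Boolₚ.¬-not λ e → b≢u (inG zero (suc b) e))
    ... | yes refl with conn zero (suc u)
    ...   | step {w = zero}  e _ = ⊥-elim (inG zero zero e)
    ...   | step {w = suc c} e _ with inG zero (suc c) e
    ...     | refl = sym e
    agree : ∀ a b → attachLeafᴮ (detachLeaf T) a b ≡ T ⟨ a , b ⟩
    agree zero    zero    = sym (loopless zero)
    agree zero    (suc b) = leaf-row b
    agree (suc a) zero    = trans (leaf-row a) (sym′ zero (suc a))
    agree (suc a) (suc b) = lookup-tabulateᴹ _ a b

  numSpanningTrees-addLeaf : ∀ {c} → NumSpanningTrees G c → NumSpanningTrees (AddLeaf G u) c
  numSpanningTrees-addLeaf = numSpanningTrees-bijection attachLeaf detachLeaf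
    isSpanningTree-attachLeaf isSpanningTree-detachLeaf (λ S _ → detach-attach S) attach-detach

-- Counting spanning trees by enumeration

endpoint : ∀ {A : Set} → A → List A → A
endpoint z []       = z
endpoint z (x ∷ xs) = endpoint x xs

unique-lookup : ∀ {A : Set} {xs : List A} → Unique xs → ∀ {i j} → i ≢ j → List.lookup xs i ≢ List.lookup xs j
unique-lookup {xs = _ ∷ _} _        {zero}  {zero}  i≢j   = ⊥-elim (i≢j refl)
unique-lookup {xs = _ ∷ _} (x∉ ∷ _) {zero}  {suc j} _   e = All.lookup x∉ (∈-lookup j) e
unique-lookup {xs = _ ∷ _} (x∉ ∷ _) {suc i} {zero}  _   e = All.lookup x∉ (∈-lookup i) (sym e)
unique-lookup {xs = _ ∷ _} (_ ∷ u)  {suc i} {suc j} i≢j   = unique-lookup u (i≢j ∘′ cong suc)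

unique⇒length≤ : ∀ {n} {xs : List (Fin n)} → Unique xs → length xs ≤ n
unique⇒length≤ {n} {xs} u with length xs ≤? n
... | yes ≤n = ≤n
... | no  ≰n with Finₚ.pigeonhole (≰⇒> ≰n) (List.lookup xs)
...   | i , j , i<j , e = ⊥-elim (unique-lookup u (Finₚ.<⇒≢ i<j) e)

listsUpTo : ∀ n → ℕ → List (List (Fin n))
listsUpTo n zero    = [] ∷ []
listsUpTo n (suc l) = [] ∷ concatMap (λ x → map (x ∷_) (listsUpTo n l)) (allFin n)

∈-listsUpTo : ∀ {n} l {xs : List (Fin n)} → length xs ≤ l → xs ∈ listsUpTo n l
∈-listsUpTo zero    {[]}     _         = here refl
∈-listsUpTo (suc l) {[]}     _         = here refl
∈-listsUpTo {n} (suc l) {x ∷ xs} (s≤s ≤l) =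
  there (∈-concatMap⁺ (λ x → map (x ∷_) (listsUpTo n l)) (lose (∈-allFin x) (∈-map⁺ (x ∷_) (∈-listsUpTo l ≤l))))

vecsOver : ∀ {A : Set} → List A → (l : ℕ) → List (Vec A l)
vecsOver xs zero    = Vec.[] ∷ []
vecsOver xs (suc l) = concatMap (λ x → map (x Vec.∷_) (vecsOver xs l)) xs

∈-vecsOver : ∀ {A : Set} {xs : List A} → (∀ a → a ∈ xs) → ∀ {l} (v : Vec A l) → v ∈ vecsOver xs l
∈-vecsOver all∈ Vec.[]         = here refl
∈-vecsOver {xs = xs} all∈ {suc l} (x Vec.∷ v) =
  ∈-concatMap⁺ (λ x → map (x Vec.∷_) (vecsOver xs l)) (lose (all∈ x) (∈-map⁺ (x Vec.∷_) (∈-vecsOver all∈ v)))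

allMatrices : ∀ n → List (Matrix n)
allMatrices n = vecsOver (vecsOver (true ∷ false ∷ []) n) n

∈-allMatrices : ∀ {n} (T : Matrix n) → T ∈ allMatrices n
∈-allMatrices T = ∈-vecsOver (∈-vecsOver ∈-bools) T
  where
  ∈-bools : ∀ b → b ∈ (true ∷ false ∷ [])
  ∈-bools true  = here refl
  ∈-bools false = there (here refl)

module _ {n} (T : Matrix n) where

  chain? : ∀ xs → Dec (Chain T xs)
  chain? []          = yes tt
  chain? (x ∷ [])    = yes tt
  chain? (x ∷ y ∷ r) = (T ⟨ x , y ⟩ Bool.≟ true) ×-dec chain? (y ∷ r)

  walk→chain : ∀ {u v} → Walk T u v → Σ (List (Fin n)) λ xs → Chain T (u ∷ xs) × endpoint u xs ≡ v
  walk→chain here       = [] , tt , refl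
  walk→chain (step {w = w} e p) = let xs , c , l = walk→chain p in w ∷ xs , (e , c) , l

  chain→walk : ∀ u xs → Chain T (u ∷ xs) → Walk T u (endpoint u xs)
  chain→walk u []       _       = here
  chain→walk u (x ∷ xs) (e , c) = step e (chain→walk x xs c)

  suffix : ∀ {z} xs → z ∈ xs → List (Fin n)
  suffix (y ∷ ys) (here _)  = ys
  suffix (y ∷ ys) (there p) = suffix ys p

  suffix-chain : ∀ {z} xs → Chain T xs → (p : z ∈ xs) → Chain T (z ∷ suffix xs p)
  suffix-chain (y ∷ ys)     c       (here refl) = c
  suffix-chain (y ∷ [])     _       (there ())
  suffix-chain (y ∷ y′ ∷ ys) (_ , c) (there p)   = suffix-chain (y′ ∷ ys) c p

  suffix-endpoint : ∀ {z} y ys → (p : z ∈ (y ∷ ys)) → endpoint z (suffix (y ∷ ys) p) ≡ endpoint y ys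
  suffix-endpoint y ys        (here refl) = refl
  suffix-endpoint y (y′ ∷ ys) (there p)   = suffix-endpoint y′ ys p

  suffix-unique : ∀ {z} xs → Unique xs → (p : z ∈ xs) → Unique (z ∷ suffix xs p)
  suffix-unique (y ∷ ys) u       (here refl) = u
  suffix-unique (y ∷ ys) (_ ∷ u) (there p)   = suffix-unique ys u p

  erase : Fin n → List (Fin n) → List (Fin n)
  erase z []       = []
  erase z (y ∷ ys) with DecMembership._∈?_ Finₚ._≟_ z (y ∷ erase y ys)
  ... | yes z∈ = suffix (y ∷ erase y ys) z∈
  ... | no  _  = y ∷ erase y ys

  erase-path : ∀ z ys → Chain T (z ∷ ys) →
               Chain T (z ∷ erase z ys) × endpoint z (erase z ys) ≡ endpoint z ys × Unique (z ∷ erase z ys)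
  erase-path z []       _       = tt , refl , ([] ∷ [])
  erase-path z (y ∷ ys) (e , c) with erase-path y ys c
  ... | c′ , l′ , u′ with DecMembership._∈?_ Finₚ._≟_ z (y ∷ erase y ys)
  ...   | yes z∈ = suffix-chain _ c′ z∈ , trans (suffix-endpoint y _ z∈) l′ , suffix-unique _ u′ z∈
  ...   | no  z∉ = (e , c′) , l′ , (¬Any⇒All¬ _ z∉ ∷ u′)

  -- by loop erasure, searching the paths with at most n vertices suffices
  walk? : ∀ u v → Dec (Walk T u v)
  walk? u v = map′ from to (Any.any? (λ xs → chain? (u ∷ xs) ×-dec (endpoint u xs Finₚ.≟ v)) (listsUpTo n n))
    where
    from : Any (λ xs → Chain T (u ∷ xs) × endpoint u xs ≡ v) (listsUpTo n n) → Walk T u v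
    from a = let xs , c , l = Any.satisfied a in subst (Walk T u) l (chain→walk u xs c)
    to : Walk T u v → Any (λ xs → Chain T (u ∷ xs) × endpoint u xs ≡ v) (listsUpTo n n)
    to w with walk→chain w
    ... | xs , c , l with erase-path u xs c
    ...   | c′ , l′ , u′ = lose (∈-listsUpTo n (≤-trans (n≤1+n _) (unique⇒length≤ u′))) (c′ , trans l′ l)

  IsCycle : List (Fin n) → Set
  IsCycle []       = ⊥
  IsCycle (v ∷ ws) = Cycle {T = T} v ws

  isCycle? : ∀ xs → Dec (IsCycle xs)
  isCycle? []       = no λ ()
  isCycle? (v ∷ ws) = (3 ≤? length (v ∷ ws)) ×-dec DecUnique.unique? Finₚ._≟_ (v ∷ ws)
                      ×-dec chain? ((v ∷ ws) ++ (v ∷ []))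

  hasCycle? : Dec (HasCycle T)
  hasCycle? = map′ from to (Any.any? isCycle? (listsUpTo n n))
    where
    from : Any IsCycle (listsUpTo n n) → HasCycle T
    from a with Any.satisfied a
    ... | v ∷ ws , cyc = v , ws , cyc
    to : HasCycle T → Any IsCycle (listsUpTo n n)
    to (v , ws , cyc) = lose (∈-listsUpTo n (unique⇒length≤ (proj₁ (proj₂ cyc)))) cyc

isSpanningTree? : ∀ {n} (G : Graph n) → (∀ a b → Dec (G a b)) → ∀ T → Dec (IsSpanningTree G T)
isSpanningTree? G G? T =
  Finₚ.all? (λ a → Finₚ.all? λ b → T ⟨ a , b ⟩ Bool.≟ T ⟨ b , a ⟩) ×-dec
  Finₚ.all? (λ a → T ⟨ a , a ⟩ Bool.≟ false) ×-dec
  Finₚ.all? (λ a → Finₚ.all? λ b → (T ⟨ a , b ⟩ Bool.≟ true) →-dec G? a b) ×-dec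
  Finₚ.all? (λ u → Finₚ.all? λ v → walk? T u v) ×-dec
  ¬? (hasCycle? T)

numSpanningTrees-exists : ∀ {n} (G : Graph n) → (∀ a b → Dec (G a b)) → Σ ℕ (NumSpanningTrees G)
numSpanningTrees-exists {n} G G? = length trees , trees , DecUniqueₚ.deduplicate-! _≟ᴹ_ candidates , sound , complete , refl
  where
  _≟ᴹ_ : DecidableEquality (Matrix n)
  _≟ᴹ_ = Vecₚ.≡-dec (Vecₚ.≡-dec Bool._≟_)
  candidates trees : List (Matrix n)
  candidates = filter (isSpanningTree? G G?) (allMatrices n)
  trees = deduplicate _≟ᴹ_ candidates
  sound : ∀ T → T ∈ trees → IsSpanningTree G T
  sound T T∈ = proj₂ (∈-filter⁻ (isSpanningTree? G G?) {xs = allMatrices n} (∈-deduplicate⁻ _≟ᴹ_ candidates T∈))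
  complete : ∀ T → IsSpanningTree G T → T ∈ trees
  complete T t = ∈-deduplicate⁺ _≟ᴹ_ (∈-filter⁺ (isSpanningTree? G G?) (∈-allMatrices T) t)

module Residue (n : ℕ) .{{_ : NonZero n}} where

  open ℤSolver

  -[1+]%ℕ : ∀ a → -[1+ a ] %ℕ n ≡ (n ∸ suc a % n) % n
  -[1+]%ℕ a with suc a % n | m%n<n (suc a) n
  ... | zero  | _   = sym (n%n≡0 n)
  ... | suc r | r<n = sym (m<n⇒m%n≡m (∸-monoʳ-< {n} {suc r} {0} (s≤s z≤n) (<⇒≤ r<n)))

  %ℕ-+n : ∀ y → (y ℤ.+ + n) %ℕ n ≡ y %ℕ n
  %ℕ-+n (+ a)    = [m+n]%n≡m%n a n
  %ℕ-+n -[1+ a ] with ≤-<-connex (suc a) n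
  ... | inj₁ 1+a≤n = trans (cong (_%ℕ n) (ℤₚ.⊖-≥ 1+a≤n)) (trans (wrap (m≤n⇒m<n∨m≡n 1+a≤n)) (sym (-[1+]%ℕ a)))
    where
    wrap : suc a < n ⊎ suc a ≡ n → (n ∸ suc a) % n ≡ (n ∸ suc a % n) % n
    wrap (inj₁ 1+a<n) = cong (λ r → (n ∸ r) % n) (sym (m<n⇒m%n≡m 1+a<n))
    wrap (inj₂ refl)  = trans (cong (_% n) (n∸n≡0 n)) (trans (sym (n%n≡0 n)) (cong (λ r → (n ∸ r) % n) (sym (n%n≡0 n))))
  ... | inj₂ n<1+a = begin
    (n ℤ.⊖ suc a) %ℕ n              ≡⟨ cong (_%ℕ n) (trans (ℤₚ.⊖-< n<1+a) (cong (λ m → ℤ.- (+ m)) 1+a∸n)) ⟩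
    -[1+ a ∸ n ] %ℕ n               ≡⟨ -[1+]%ℕ (a ∸ n) ⟩
    (n ∸ suc (a ∸ n) % n) % n       ≡⟨ cong (λ r → (n ∸ r) % n) reduce ⟩
    (n ∸ suc a % n) % n             ≡⟨ sym (-[1+]%ℕ a) ⟩
    -[1+ a ] %ℕ n                   ∎
    where
    open ≡-Reasoning
    1+a∸n : suc a ∸ n ≡ suc (a ∸ n)
    1+a∸n = +-∸-assoc 1 (≤-pred n<1+a)
    reduce : suc (a ∸ n) % n ≡ suc a % n
    reduce = trans (sym ([m+n]%n≡m%n (suc (a ∸ n)) n)) (cong (λ m → suc m % n) (m∸n+n≡m (≤-pred n<1+a)))

  %ℕ-+ℕ*n : ∀ y t → (y ℤ.+ + (t * n)) %ℕ n ≡ y %ℕ n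
  %ℕ-+ℕ*n y zero    = cong (_%ℕ n) (ℤₚ.+-identityʳ y)
  %ℕ-+ℕ*n y (suc t) = trans (cong (_%ℕ n) regroup) (trans (%ℕ-+n (y ℤ.+ + (t * n))) (%ℕ-+ℕ*n y t))
    where
    regroup : y ℤ.+ + (n + t * n) ≡ (y ℤ.+ + (t * n)) ℤ.+ + n
    regroup rewrite ℤₚ.pos-+ n (t * n) =
      solve 3 (λ y a b → y :+ (a :+ b) := (y :+ b) :+ a) refl y (+ n) (+ (t * n))

  %ℕ-+ℤ*n : ∀ y q → (y ℤ.+ q ℤ.* + n) %ℕ n ≡ y %ℕ n
  %ℕ-+ℤ*n y (+ t)    = trans (cong (λ w → (y ℤ.+ w) %ℕ n) (sym (ℤₚ.pos-* t n))) (%ℕ-+ℕ*n y t)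
  %ℕ-+ℤ*n y -[1+ t ] = sym (trans (cong (_%ℕ n) (sym cancel)) (%ℕ-+ℕ*n z (suc t)))
    where
    z : ℤ
    z = y ℤ.+ -[1+ t ] ℤ.* + n
    cancel : z ℤ.+ + (suc t * n) ≡ y
    cancel rewrite ℤₚ.pos-* (suc t) n | sym (ℤₚ.neg-distribˡ-* (+ suc t) (+ n)) =
      solve 2 (λ y w → (y :+ (:- w)) :+ w := y) refl y (+ suc t ℤ.* + n)

  %ℕ-+ℕ : ∀ x c → (x ℤ.+ + c) %ℕ n ≡ (x %ℕ n + c) % n
  %ℕ-+ℕ x c = trans (cong (_%ℕ n) split) (%ℕ-+ℤ*n (+ (x %ℕ n + c)) (x /ℕ n))
    where
    split : x ℤ.+ + c ≡ + (x %ℕ n + c) ℤ.+ x /ℕ n ℤ.* + n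
    split rewrite ℤₚ.pos-+ (x %ℕ n) c =
      trans (cong (ℤ._+ + c) (a≡a%ℕn+[a/ℕn]*n x n))
            (solve 3 (λ r q c → (r :+ q) :+ c := (r :+ c) :+ q) refl (+ (x %ℕ n)) (x /ℕ n ℤ.* + n) (+ c))

  %ℕ-+-distrib : ∀ x z → (x ℤ.+ z) %ℕ n ≡ (x %ℕ n + z %ℕ n) % n
  %ℕ-+-distrib x z = trans (cong (_%ℕ n) split) (trans (%ℕ-+ℤ*n (x ℤ.+ + (z %ℕ n)) (z /ℕ n)) (%ℕ-+ℕ x (z %ℕ n)))
    where
    split : x ℤ.+ z ≡ x ℤ.+ + (z %ℕ n) ℤ.+ z /ℕ n ℤ.* + n
    split = trans (cong (λ w → x ℤ.+ w) (a≡a%ℕn+[a/ℕn]*n z n))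
                  (solve 3 (λ x r q → x :+ (r :+ q) := (x :+ r) :+ q) refl x (+ (z %ℕ n)) (z /ℕ n ℤ.* + n))

  %ℕ-congʳ : ∀ x y z → x %ℕ n ≡ y %ℕ n → (x ℤ.+ z) %ℕ n ≡ (y ℤ.+ z) %ℕ n
  %ℕ-congʳ x y z x≡y = trans (%ℕ-+-distrib x z) (trans (cong (λ r → (r + z %ℕ n) % n) x≡y) (sym (%ℕ-+-distrib y z)))

  %ℕ-absorbˡ : ∀ x z → (+ (x %ℕ n) ℤ.+ z) %ℕ n ≡ (x ℤ.+ z) %ℕ n
  %ℕ-absorbˡ x z = %ℕ-congʳ (+ (x %ℕ n)) x z (m<n⇒m%n≡m (n%ℕd<d x n))

  %ℕ-cancelʳ : ∀ x y z → (x ℤ.+ z) %ℕ n ≡ (y ℤ.+ z) %ℕ n → x %ℕ n ≡ y %ℕ n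
  %ℕ-cancelʳ x y z e = subst₂ (λ a b → a %ℕ n ≡ b %ℕ n) (undo x) (undo y) (%ℕ-congʳ (x ℤ.+ z) (y ℤ.+ z) (ℤ.- z) e)
    where
    undo : ∀ w → w ℤ.+ z ℤ.+ ℤ.- z ≡ w
    undo w = solve 2 (λ w z → w :+ z :+ (:- z) := w) refl w z


-- Positions on the square cycle, counted from v_{j+2}

Link : (n : ℕ) .{{_ : NonZero n}} → ℕ → ℕ → ℕ → ℕ → Set
Link n q₁ q₂ p d = (q₁ ≡ p × q₂ ≡ (d + p) % n) ⊎ (q₂ ≡ p × q₁ ≡ (d + p) % n)

link-sym : ∀ {n} .{{_ : NonZero n}} {q₁ q₂ p d} → Link n q₁ q₂ p d → Link n q₂ q₁ p d
link-sym (inj₁ e) = inj₂ e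
link-sym (inj₂ e) = inj₁ e

module Positions (n : ℕ) .{{_ : NonZero n}} (j : ℤ) where

  open Residue n
  open ℤSolver

  origin : ℤ
  origin = j ℤ.+ + 2

  pos : ℤ → ℕ
  pos x = (x ℤ.- origin) %ℕ n

  position : Fin n → ℕ
  position a = pos (+ toℕ a)

  vertex : ℕ → Fin n
  vertex q = fromℕ< (n%ℕd<d (+ q ℤ.+ origin) n)

  pos<n : ∀ x → pos x < n
  pos<n x = n%ℕd<d (x ℤ.- origin) n

  toℕ-vertex : ∀ q → toℕ (vertex q) ≡ (+ q ℤ.+ origin) %ℕ n
  toℕ-vertex q = toℕ-fromℕ< (n%ℕd<d (+ q ℤ.+ origin) n)

  private
    shift-back : ∀ x → x ℤ.- origin ℤ.+ origin ≡ x
    shift-back x = solve 2 (λ x o → x :- o :+ o := x) refl x origin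

    shift-forth : ∀ x → x ℤ.+ origin ℤ.- origin ≡ x
    shift-forth x = solve 2 (λ x o → x :+ o :- o := x) refl x origin

  vertex-position : ∀ a → vertex (position a) ≡ a
  vertex-position a = toℕ-injective (begin
    toℕ (vertex (position a))                 ≡⟨ toℕ-vertex (position a) ⟩
    (+ position a ℤ.+ origin) %ℕ n            ≡⟨ %ℕ-absorbˡ (+ toℕ a ℤ.- origin) origin ⟩
    (+ toℕ a ℤ.- origin ℤ.+ origin) %ℕ n      ≡⟨ cong (_%ℕ n) (shift-back (+ toℕ a)) ⟩
    toℕ a % n                                 ≡⟨ m<n⇒m%n≡m (toℕ<n a) ⟩
    toℕ a                                     ∎)
    where open ≡-Reasoning

  position-vertex : ∀ {q} → q < n → position (vertex q) ≡ q
  position-vertex {q} q<n = begin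
    position (vertex q)                       ≡⟨ cong (λ r → pos (+ r)) (toℕ-vertex q) ⟩
    (+ ((+ q ℤ.+ origin) %ℕ n) ℤ.- origin) %ℕ n ≡⟨ %ℕ-absorbˡ (+ q ℤ.+ origin) (ℤ.- origin) ⟩
    (+ q ℤ.+ origin ℤ.- origin) %ℕ n          ≡⟨ cong (_%ℕ n) (shift-forth (+ q)) ⟩
    q % n                                     ≡⟨ m<n⇒m%n≡m q<n ⟩
    q                                         ∎
    where open ≡-Reasoning

  toℕ≡⇒position≡ : ∀ {a} x → toℕ a ≡ x %ℕ n → position a ≡ pos x
  toℕ≡⇒position≡ {a} x e = %ℕ-congʳ (+ toℕ a) x (ℤ.- origin) (trans (m<n⇒m%n≡m (toℕ<n a)) e)

  position≡⇒toℕ≡ : ∀ {a} x → position a ≡ pos x → toℕ a ≡ x %ℕ n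
  position≡⇒toℕ≡ {a} x e = trans (sym (m<n⇒m%n≡m (toℕ<n a))) (%ℕ-cancelʳ (+ toℕ a) x (ℤ.- origin) e)

  pos-+ : ∀ x d → pos (x ℤ.+ + d) ≡ (d + pos x) % n
  pos-+ x d = begin
    (x ℤ.+ + d ℤ.- origin) %ℕ n   ≡⟨ cong (_%ℕ n) (solve 3 (λ x d o → x :+ d :- o := x :- o :+ d) refl x (+ d) origin) ⟩
    (x ℤ.- origin ℤ.+ + d) %ℕ n   ≡⟨ %ℕ-+ℕ (x ℤ.- origin) d ⟩
    (pos x + d) % n               ≡⟨ cong (_% n) (+-comm (pos x) d) ⟩
    (d + pos x) % n               ∎
    where open ≡-Reasoning

  pos-j : 2 < n → pos j ≡ n ∸ 2
  pos-j 2<n = begin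
    (j ℤ.- origin) %ℕ n  ≡⟨ cong (_%ℕ n) (solve 1 (λ j → j :- (j :+ con (+ 2)) := con -[1+ 1 ]) refl j) ⟩
    -[1+ 1 ] %ℕ n        ≡⟨ -[1+]%ℕ 1 ⟩
    (n ∸ 2 % n) % n      ≡⟨ cong (λ r → (n ∸ r) % n) (m<n⇒m%n≡m 2<n) ⟩
    (n ∸ 2) % n          ≡⟨ m<n⇒m%n≡m (∸-monoʳ-< {n} {2} {0} (s≤s z≤n) (<⇒≤ 2<n)) ⟩
    n ∸ 2                ∎
    where open ≡-Reasoning

  pos-j+ : 2 < n → ∀ t → pos (j ℤ.+ + t) ≡ (t + (n ∸ 2)) % n
  pos-j+ 2<n t = trans (pos-+ j t) (cong (λ r → (t + r) % n) (pos-j 2<n))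

  pairEdge⇒link : ∀ x d {a b} → PairEdge n x (x ℤ.+ + d) a b → Link n (position a) (position b) (pos x) d
  pairEdge⇒link x d (inj₁ (a≡ , b≡)) =
    inj₁ (toℕ≡⇒position≡ x a≡ , trans (toℕ≡⇒position≡ (x ℤ.+ + d) b≡) (pos-+ x d))
  pairEdge⇒link x d (inj₂ (a≡ , b≡)) =
    inj₂ (toℕ≡⇒position≡ x b≡ , trans (toℕ≡⇒position≡ (x ℤ.+ + d) a≡) (pos-+ x d))

  link⇒pairEdge : ∀ x d {a b} → Link n (position a) (position b) (pos x) d → PairEdge n x (x ℤ.+ + d) a b
  link⇒pairEdge x d (inj₁ (a≡ , b≡)) =
    inj₁ (position≡⇒toℕ≡ x a≡ , position≡⇒toℕ≡ (x ℤ.+ + d) (trans b≡ (sym (pos-+ x d))))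
  link⇒pairEdge x d (inj₂ (b≡ , a≡)) =
    inj₂ (position≡⇒toℕ≡ (x ℤ.+ + d) (trans a≡ (sym (pos-+ x d))) , position≡⇒toℕ≡ x b≡)

-- The edges of the strip graph with tails, by position

data Gap : ℕ → Set where
  frame  : Gap 1
  window : Gap 2

Adjacent : ℕ → ℕ → Set
Adjacent a b = (b ≡ a + 1) ⊎ (b ≡ a + 2) ⊎ (a ≡ b + 1) ⊎ (a ≡ b + 2)

adjacent? : ∀ a b → Dec (Adjacent a b)
adjacent? a b = (b ≟ a + 1) ⊎-dec (b ≟ a + 2) ⊎-dec (a ≟ b + 1) ⊎-dec (a ≟ b + 2)

adjacent-+ˡ : ∀ c {a b} → Adjacent a b → Adjacent (c + a) (c + b)
adjacent-+ˡ c {a} {b} (inj₁ e)               = inj₁ (trans (cong (λ x → c + x) e) (sym (+-assoc c a 1)))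
adjacent-+ˡ c {a} {b} (inj₂ (inj₁ e))        = inj₂ (inj₁ (trans (cong (λ x → c + x) e) (sym (+-assoc c a 2))))
adjacent-+ˡ c {a} {b} (inj₂ (inj₂ (inj₁ e))) = inj₂ (inj₂ (inj₁ (trans (cong (λ x → c + x) e) (sym (+-assoc c b 1)))))
adjacent-+ˡ c {a} {b} (inj₂ (inj₂ (inj₂ e))) = inj₂ (inj₂ (inj₂ (trans (cong (λ x → c + x) e) (sym (+-assoc c b 2)))))

adjacent-+ˡ⁻ : ∀ c {a b} → Adjacent (c + a) (c + b) → Adjacent a b
adjacent-+ˡ⁻ c {a} {b} (inj₁ e)               = inj₁ (+-cancelˡ-≡ c _ _ (trans e (+-assoc c a 1)))
adjacent-+ˡ⁻ c {a} {b} (inj₂ (inj₁ e))        = inj₂ (inj₁ (+-cancelˡ-≡ c _ _ (trans e (+-assoc c a 2))))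
adjacent-+ˡ⁻ c {a} {b} (inj₂ (inj₂ (inj₁ e))) = inj₂ (inj₂ (inj₁ (+-cancelˡ-≡ c _ _ (trans e (+-assoc c b 1)))))
adjacent-+ˡ⁻ c {a} {b} (inj₂ (inj₂ (inj₂ e))) = inj₂ (inj₂ (inj₂ (+-cancelˡ-≡ c _ _ (trans e (+-assoc c b 2)))))

m+[o∸[m+n]]≡o∸n : ∀ {m n o} → m + n ≤ o → m + (o ∸ (m + n)) ≡ o ∸ n
m+[o∸[m+n]]≡o∸n {m} {n} {o} m+n≤o = sym (begin
  o ∸ n                       ≡⟨ cong (_∸ n) (sym (m+[n∸m]≡n m+n≤o)) ⟩
  m + n + (o ∸ (m + n)) ∸ n   ≡⟨ cong (_∸ n) (trans (+-assoc m n t) (trans (cong (λ x → m + x) (+-comm n t)) (sym (+-assoc m t n)))) ⟩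
  m + t + n ∸ n               ≡⟨ m+n∸n≡m (m + t) n ⟩
  m + t                       ∎)
  where
  open ≡-Reasoning
  t : ℕ
  t = o ∸ (m + n)

module Classification (n k : ℕ) .{{_ : NonZero n}} (5≤n : 5 ≤ n) (2k<n : 2 * k < n) where

  open Residue n

  K : ℕ
  K = 2 * k

  -- By starting position: f_j at n − 2, e_{j+1} at n − 1, e_{j+2}, …, e_{j+2k+1} at
  -- 0, …, K − 1, and f_{j+2k+1} at K − 1 (at n − 1 when k = 0).
  data Escapes : ℕ → ℕ → Set where
    frame-first  : ∀ {p} → 1 + p ≡ n → Escapes 1 p
    frame-inner  : ∀ {p} → p < K → Escapes 1 p
    window-first : ∀ {p} → 2 + p ≡ n → Escapes 2 p
    window-last  : ∀ {p} → 1 ≤ k → 1 + p ≡ K → Escapes 2 p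
    window-last₀ : ∀ {p} → k ≡ 0 → 1 + p ≡ n → Escapes 2 p

  -- closing-window is f_{j+1}, from n − 1 to 1, which joins the odd tail to the strip
  data Survives : ℕ → ℕ → Set where
    strip-frame    : ∀ {p} → K ≤ p → 2 + p ≤ n → Survives 1 p
    strip-window   : ∀ {p} → K ≤ p → 3 + p ≤ n → Survives 2 p
    tail-window    : ∀ {p} → 2 + p ≤ K → Survives 2 p
    closing-window : ∀ {p} → 1 ≤ k → 1 + p ≡ n → Survives 2 p

  survives⇒gap : ∀ {d p} → Survives d p → Gap d
  survives⇒gap (strip-frame _ _)    = frame
  survives⇒gap (strip-window _ _)   = window
  survives⇒gap (tail-window _)      = window
  survives⇒gap (closing-window _ _) = window

  escapes⇒gap : ∀ {d p} → Escapes d p → Gap d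
  escapes⇒gap (frame-first _)    = frame
  escapes⇒gap (frame-inner _)    = frame
  escapes⇒gap (window-first _)   = window
  escapes⇒gap (window-last _ _)  = window
  escapes⇒gap (window-last₀ _ _) = window

  private
    ≤-suc-≢ : ∀ {a b} → a ≤ suc b → a ≢ suc b → a ≤ b
    ≤-suc-≢ a≤ a≢ = ≤-pred (≤∧≢⇒< a≤ a≢)

    K>x⇒k≥1 : ∀ {x} → x < K → 1 ≤ k
    K>x⇒k≥1 {x} x<K = n≢0⇒n>0 λ k≡0 → n≮0 (subst (x <_) (cong (2 *_) k≡0) x<K)

  survives⊎escapes : ∀ {d p} → p < n → Gap d → Survives d p ⊎ Escapes d p
  survives⊎escapes {p = p} p<n frame with p <? K
  ... | yes p<K = inj₂ (frame-inner p<K)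
  ... | no  p≮K with 2 + p ≤? n
  ...   | yes 2+p≤n = inj₁ (strip-frame (≮⇒≥ p≮K) 2+p≤n)
  ...   | no  2+p≰n = inj₂ (frame-first (≤-antisym p<n (≤-pred (≰⇒> 2+p≰n))))
  survives⊎escapes {p = p} p<n window with 2 + p ≤? K
  ... | yes 2+p≤K = inj₁ (tail-window 2+p≤K)
  ... | no  2+p≰K with 1 + p ≟ K
  ...   | yes 1+p≡K = inj₂ (window-last (K>x⇒k≥1 (≤-reflexive 1+p≡K)) 1+p≡K)
  ...   | no  1+p≢K with 3 + p ≤? n
  ...     | yes 3+p≤n = inj₁ (strip-window (≤-suc-≢ (≤-pred (≰⇒> 2+p≰K)) (1+p≢K ∘′ sym)) 3+p≤n)
  ...     | no  3+p≰n with 2 + p ≟ n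
  ...       | yes 2+p≡n = inj₂ (window-first 2+p≡n)
  ...       | no  2+p≢n with ≤-antisym p<n (≤-suc-≢ (≤-pred (≰⇒> 3+p≰n)) (2+p≢n ∘′ sym)) | k ≟ 0
  ...         | 1+p≡n | yes k≡0 = inj₂ (window-last₀ k≡0 1+p≡n)
  ...         | 1+p≡n | no  k≢0 = inj₁ (closing-window (n≢0⇒n>0 k≢0) 1+p≡n)

  survives⇒¬escapes : ∀ {d p} → Survives d p → ¬ Escapes d p
  survives⇒¬escapes (strip-frame _ 2+p≤n)   (frame-first 1+p≡n)    = <-irrefl 1+p≡n 2+p≤n
  survives⇒¬escapes (strip-frame K≤p _)     (frame-inner p<K)      = <⇒≱ p<K K≤p
  survives⇒¬escapes (strip-window _ 3+p≤n)  (window-first 2+p≡n)   = <-irrefl 2+p≡n 3+p≤n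
  survives⇒¬escapes (strip-window K≤p _)    (window-last _ 1+p≡K)  = <-irrefl (sym 1+p≡K) (s≤s K≤p)
  survives⇒¬escapes (strip-window _ 3+p≤n)  (window-last₀ _ 1+p≡n) = <-irrefl 1+p≡n (≤-trans (n≤1+n _) 3+p≤n)
  survives⇒¬escapes (tail-window 2+p≤K)     (window-first 2+p≡n)   = <⇒≱ 2k<n (subst (_≤ K) 2+p≡n 2+p≤K)
  survives⇒¬escapes (tail-window 2+p≤K)     (window-last _ 1+p≡K)  = <-irrefl 1+p≡K 2+p≤K
  survives⇒¬escapes (tail-window 2+p≤K)     (window-last₀ refl _)  = <⇒≱ z<s 2+p≤K
  survives⇒¬escapes (closing-window _ 1+p≡n) (window-first 2+p≡n)  = 1+n≢n (trans 2+p≡n (sym 1+p≡n))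
  survives⇒¬escapes (closing-window _ 1+p≡n) (window-last _ 1+p≡K) = <-irrefl (trans (sym 1+p≡K) 1+p≡n) 2k<n
  survives⇒¬escapes (closing-window k>0 _)  (window-last₀ refl _)  = <-irrefl refl k>0

  private
    gap≤2 : ∀ {d} → Gap d → d ≤ 2
    gap≤2 frame  = s≤s z≤n
    gap≤2 window = ≤-refl

    gap+gap<n : ∀ {d d′} → Gap d → Gap d′ → d + d′ < n
    gap+gap<n g g′ = <-≤-trans (s≤s (+-mono-≤ (gap≤2 g) (gap≤2 g′))) 5≤n

    gap<n : ∀ {d} → Gap d → d < n
    gap<n {d} g = ≤-<-trans (m≤m+n d d) (gap+gap<n g g)

    gap+gap≢0 : ∀ {d d′} → Gap d → Gap d′ → 0 ≢ d + d′
    gap+gap≢0 frame  _ ()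
    gap+gap≢0 window _ ()

    %-absorbʳ : ∀ a b → (a + b % n) % n ≡ (a + b) % n
    %-absorbʳ a b = begin
      (a + b % n) % n          ≡⟨ %-distribˡ-+ a (b % n) n ⟩
      (a % n + b % n % n) % n  ≡⟨ cong (λ r → (a % n + r) % n) (m%n%n≡m%n b n) ⟩
      (a % n + b % n) % n      ≡⟨ sym (%-distribˡ-+ a b n) ⟩
      (a + b) % n              ∎
      where open ≡-Reasoning

    -- going forward by d and then by d′ cannot return, as 0 < d + d′ < n
    no-return : ∀ {d d′ p} → Gap d → Gap d′ → p ≡ (d′ + (d + p) % n) % n → ⊥
    no-return {d} {d′} {p} g g′ e = gap+gap≢0 g′ g (begin
      0                  ≡⟨ sym (m<n⇒m%n≡m (≤-<-trans z≤n (gap+gap<n g′ g))) ⟩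
      0 % n              ≡⟨ %ℕ-cancelʳ (+ 0) (+ (d′ + d)) (+ p) round-trip ⟩
      (d′ + d) % n       ≡⟨ m<n⇒m%n≡m (gap+gap<n g′ g) ⟩
      d′ + d             ∎)
      where
      open ≡-Reasoning
      round-trip : p % n ≡ (d′ + d + p) % n
      round-trip = begin
        p % n                     ≡⟨ m<n⇒m%n≡m (subst (_< n) (sym e) (m%n<n _ n)) ⟩
        p                         ≡⟨ e ⟩
        (d′ + (d + p) % n) % n    ≡⟨ %-absorbʳ d′ (d + p) ⟩
        (d′ + (d + p)) % n        ≡⟨ cong (_% n) (sym (+-assoc d′ d p)) ⟩
        (d′ + d + p) % n          ∎

    same-start : ∀ {d d′ p} → Gap d → Gap d′ → (d + p) % n ≡ (d′ + p) % n → d ≡ d′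
    same-start {d} {d′} {p} g g′ e =
      trans (sym (m<n⇒m%n≡m (gap<n g))) (trans (%ℕ-cancelʳ (+ d) (+ d′) (+ p) e) (m<n⇒m%n≡m (gap<n g′)))

  link-unique : ∀ {q₁ q₂ p p′ d d′} → Gap d → Gap d′ →
                Link n q₁ q₂ p d → Link n q₁ q₂ p′ d′ → p ≡ p′ × d ≡ d′
  link-unique g g′ (inj₁ (refl , b)) (inj₁ (refl , b′)) = refl , same-start g g′ (trans (sym b) b′)
  link-unique g g′ (inj₂ (refl , a)) (inj₂ (refl , a′)) = refl , same-start g g′ (trans (sym a) a′)
  link-unique g g′ (inj₁ (refl , b)) (inj₂ (refl , a′)) = ⊥-elim (no-return g g′ (subst (λ q → _ ≡ (_ + q) % n) b a′))
  link-unique g g′ (inj₂ (refl , a)) (inj₁ (refl , b′)) = ⊥-elim (no-return g g′ (subst (λ q → _ ≡ (_ + q) % n) a b′))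

  Kept : ℕ → ℕ → Set
  Kept q₁ q₂ = Σ ℕ λ p → Σ ℕ λ d → p < n × Link n q₁ q₂ p d × Survives d p

  kept-sym : ∀ {q₁ q₂} → Kept q₁ q₂ → Kept q₂ q₁
  kept-sym (p , d , p<n , l , s) = p , d , p<n , link-sym l , s

  private
    ≡%n : ∀ {x y} → y < n → x ≡ y % n → x ≡ y
    ≡%n y<n e = trans e (m<n⇒m%n≡m y<n)

    wrap : ∀ {p} → 1 + p ≡ n → (2 + p) % n ≡ 1
    wrap 1+p≡n = trans (cong (λ x → suc x % n) 1+p≡n)
                       (trans ([m+n]%n≡m%n 1 n) (m<n⇒m%n≡m (≤-trans (s≤s (s≤s z≤n)) 5≤n)))

    2≤K : 1 ≤ k → 2 ≤ K
    2≤K = *-monoʳ-≤ 2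

  kept⇒adjacent : ∀ {a b} → K ≤ a → K ≤ b → Kept a b → Adjacent a b
  kept⇒adjacent _ _ (p , _ , _ , inj₁ (refl , b≡) , strip-frame _ 2+p≤n) =
    inj₁ (trans (≡%n 2+p≤n b≡) (+-comm 1 p))
  kept⇒adjacent _ _ (p , _ , _ , inj₂ (refl , a≡) , strip-frame _ 2+p≤n) =
    inj₂ (inj₂ (inj₁ (trans (≡%n 2+p≤n a≡) (+-comm 1 p))))
  kept⇒adjacent _ _ (p , _ , _ , inj₁ (refl , b≡) , strip-window _ 3+p≤n) =
    inj₂ (inj₁ (trans (≡%n 3+p≤n b≡) (+-comm 2 p)))
  kept⇒adjacent _ _ (p , _ , _ , inj₂ (refl , a≡) , strip-window _ 3+p≤n) =
    inj₂ (inj₂ (inj₂ (trans (≡%n 3+p≤n a≡) (+-comm 2 p))))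
  kept⇒adjacent K≤p _ (p , _ , _ , inj₁ (refl , _) , tail-window 2+p≤K) =
    ⊥-elim (<⇒≱ (≤-trans (n≤1+n _) 2+p≤K) K≤p)
  kept⇒adjacent _ K≤p (p , _ , _ , inj₂ (refl , _) , tail-window 2+p≤K) =
    ⊥-elim (<⇒≱ (≤-trans (n≤1+n _) 2+p≤K) K≤p)
  kept⇒adjacent _ K≤b (p , _ , _ , inj₁ (refl , b≡) , closing-window k>0 1+p≡n) =
    ⊥-elim (<⇒≱ (subst (_< K) (sym (trans b≡ (wrap 1+p≡n))) (2≤K k>0)) K≤b)
  kept⇒adjacent K≤a _ (p , _ , _ , inj₂ (refl , a≡) , closing-window k>0 1+p≡n) =
    ⊥-elim (<⇒≱ (subst (_< K) (sym (trans a≡ (wrap 1+p≡n))) (2≤K k>0)) K≤a)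

  private
    step-link : ∀ {a b d} → d + a < n → b ≡ d + a → Link n a b a d
    step-link lt b≡ = inj₁ (refl , trans b≡ (sym (m<n⇒m%n≡m lt)))

    forward-kept : ∀ {a b} → K ≤ a → b < n → b ≡ a + 1 ⊎ b ≡ a + 2 → Kept a b
    forward-kept {a} K≤a b<n (inj₁ refl) =
      a , 1 , <-trans (n<1+n a) lt , step-link lt (+-comm a 1) , strip-frame K≤a lt
      where
      lt : 1 + a < n
      lt = subst (_< n) (+-comm a 1) b<n
    forward-kept {a} K≤a b<n (inj₂ refl) =
      a , 2 , <-trans (m<n+m a z<s) lt , step-link lt (+-comm a 2) , strip-window K≤a lt
      where
      lt : 2 + a < n
      lt = subst (_< n) (+-comm a 2) b<n

  adjacent⇒kept : ∀ {a b} → K ≤ a → K ≤ b → a < n → b < n → Adjacent a b → Kept a b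
  adjacent⇒kept K≤a _   _   b<n (inj₁ e)               = forward-kept K≤a b<n (inj₁ e)
  adjacent⇒kept K≤a _   _   b<n (inj₂ (inj₁ e))        = forward-kept K≤a b<n (inj₂ e)
  adjacent⇒kept _   K≤b a<n _   (inj₂ (inj₂ (inj₁ e))) = kept-sym (forward-kept K≤b a<n (inj₁ e))
  adjacent⇒kept _   K≤b a<n _   (inj₂ (inj₂ (inj₂ e))) = kept-sym (forward-kept K≤b a<n (inj₂ e))

  data TailLink (q w : ℕ) : Set where
    tail-up    : 2 + q ≤ K → w ≡ 2 + q → TailLink q w
    tail-down  : 2 + w ≡ q → TailLink q w
    tail-close : q ≡ 1 → 1 + w ≡ n → TailLink q w

  private
    ≤K⇒<n : ∀ {x} → x ≤ K → x < n
    ≤K⇒<n x≤K = ≤-<-trans x≤K 2k<n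

  kept⇒tailLink : ∀ {q w} → q < K → Kept q w → TailLink q w
  kept⇒tailLink q<K (p , _ , _ , inj₁ (refl , _) , strip-frame K≤p _)    = ⊥-elim (<⇒≱ q<K K≤p)
  kept⇒tailLink q<K (p , _ , _ , inj₁ (refl , _) , strip-window K≤p _)   = ⊥-elim (<⇒≱ q<K K≤p)
  kept⇒tailLink q<K (p , _ , _ , inj₂ (refl , q≡) , strip-frame K≤p 2+p≤n) =
    ⊥-elim (<⇒≱ q<K (≤-trans K≤p (≤-trans (n≤1+n p) (≤-reflexive (sym (≡%n 2+p≤n q≡))))))
  kept⇒tailLink q<K (p , _ , _ , inj₂ (refl , q≡) , strip-window K≤p 3+p≤n) =
    ⊥-elim (<⇒≱ q<K (≤-trans K≤p (≤-trans (m≤n+m p 2) (≤-reflexive (sym (≡%n 3+p≤n q≡))))))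
  kept⇒tailLink _ (p , _ , _ , inj₁ (refl , w≡) , tail-window 2+p≤K) =
    tail-up 2+p≤K (≡%n (≤K⇒<n 2+p≤K) w≡)
  kept⇒tailLink _ (p , _ , _ , inj₂ (refl , q≡) , tail-window 2+p≤K) =
    tail-down (sym (≡%n (≤K⇒<n 2+p≤K) q≡))
  kept⇒tailLink q<K (p , _ , _ , inj₁ (refl , _) , closing-window _ 1+p≡n) =
    ⊥-elim (<⇒≱ 2k<n (subst (_≤ K) 1+p≡n q<K))
  kept⇒tailLink _ (p , _ , _ , inj₂ (refl , q≡) , closing-window _ 1+p≡n) =
    tail-close (trans q≡ (wrap 1+p≡n)) 1+p≡n

  tailLink⇒kept : ∀ {q w} → q < K → w < n → TailLink q w → Kept q w
  tailLink⇒kept {q} q<K _ (tail-up 2+q≤K refl) =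
    q , 2 , ≤K⇒<n (<⇒≤ q<K) , step-link (≤K⇒<n 2+q≤K) refl , tail-window 2+q≤K
  tailLink⇒kept {q} {w} q<K w<n (tail-down refl) =
    w , 2 , w<n , link-sym (step-link (≤K⇒<n (<⇒≤ q<K)) refl) , tail-window (<⇒≤ q<K)
  tailLink⇒kept {q} {w} q<K w<n (tail-close refl 1+w≡n) =
    w , 2 , w<n , inj₂ (refl , sym (wrap 1+w≡n)) , closing-window (K>x⇒k≥1 q<K) 1+w≡n

  private
    parity-K : parity K ≡ 0ℙ
    parity-K = ℙₚ.*-homo-* 2 k

    +≡0ℙ⇒≡ : ∀ p q → p ℙ.+ q ≡ 0ℙ → p ≡ q
    +≡0ℙ⇒≡ 0ℙ 0ℙ _ = refl
    +≡0ℙ⇒≡ 1ℙ 1ℙ _ = refl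

    parity-K∸ : ∀ {x} → x ≤ K → parity (K ∸ x) ≡ parity x
    parity-K∸ {x} x≤K = +≡0ℙ⇒≡ _ _
      (trans (sym (ℙₚ.+-homo-+ (K ∸ x) x)) (trans (cong parity (m∸n+n≡m x≤K)) parity-K))

    odd⇒<K : ∀ {x} → parity x ≡ 1ℙ → x ≤ K → x < K
    odd⇒<K {x} odd x≤K = ≤∧≢⇒< x≤K λ x≡K → ℙₚ.p≢p⁻¹ 0ℙ (trans (sym parity-K) (trans (cong parity (sym x≡K)) odd))

    odd⇒>0 : ∀ {x} → parity x ≡ 1ℙ → 0 < x
    odd⇒>0 {suc x} _ = z<s

  -- τ relabels tail positions in the order in which leaves are attached: it fixes the
  -- even tail 0, 2, …, K and reverses the odd tail 1, 3, …, K − 1.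
  τ : ℕ → ℕ
  τ x with x <? K | parity x
  ... | yes _ | 1ℙ = K ∸ x
  ... | _     | _  = x

  τ-≥ : ∀ {x} → K ≤ x → τ x ≡ x
  τ-≥ {x} K≤x with x <? K
  ... | yes x<K = ⊥-elim (<⇒≱ x<K K≤x)
  ... | no  _   = refl

  τ-even : ∀ {x} → parity x ≡ 0ℙ → τ x ≡ x
  τ-even {x} even with x <? K | parity x
  ... | yes _ | 0ℙ = refl
  ... | no  _ | _  = refl

  τ-odd : ∀ {x} → x < K → parity x ≡ 1ℙ → τ x ≡ K ∸ x
  τ-odd {x} x<K odd with x <? K | parity x
  ... | yes _ | 1ℙ = refl
  ... | no x≮K | _ = ⊥-elim (x≮K x<K)

  τ-involutive : ∀ x → τ (τ x) ≡ x
  τ-involutive x with x <? K | parity x in px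
  ... | no  x≮K | _  = τ-≥ (≮⇒≥ x≮K)
  ... | yes _   | 0ℙ = τ-even px
  ... | yes x<K | 1ℙ = trans (τ-odd (∸-monoʳ-< (odd⇒>0 px) (<⇒≤ x<K)) (trans (parity-K∸ (<⇒≤ x<K)) px))
                             (m∸[m∸n]≡n (<⇒≤ x<K))

  τ<n : ∀ {x} → x < n → τ x < n
  τ<n {x} x<n with x <? K | parity x
  ... | yes _ | 1ℙ = ≤-<-trans (m∸n≤m K x) 2k<n
  ... | yes _ | 0ℙ = x<n
  ... | no  _ | _  = x<n

  τ<K : ∀ {x} → x < K → τ x < K
  τ<K {x} x<K with x <? K | parity x in px
  ... | yes _ | 1ℙ = ∸-monoʳ-< (odd⇒>0 px) (<⇒≤ x<K)
  ... | yes _ | 0ℙ = x<K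
  ... | no  x≮K | _ = ⊥-elim (x≮K x<K)

  data Hang (p r : ℕ) : Set where
    hang-step : 2 + p ≤ K → r ≡ 2 + p → Hang p r
    hang-end  : 1 + p ≡ K → 1 + r ≡ n → Hang p r

  tailLink⇒hang-even : ∀ {p r} → parity p ≡ 0ℙ → p < r → TailLink (τ p) (τ r) → Hang p r
  tailLink⇒hang-even {p} {r} even p<r (tail-up 2+τp≤K τr≡) =
    hang-step (subst (λ x → 2 + x ≤ K) (τ-even even) 2+τp≤K) (begin
    r             ≡⟨ sym (τ-involutive r) ⟩
    τ (τ r)       ≡⟨ cong τ (trans τr≡ (cong (λ x → 2 + x) (τ-even even))) ⟩
    τ (2 + p)     ≡⟨ τ-even even ⟩
    2 + p         ∎)
    where open ≡-Reasoning
  tailLink⇒hang-even {p} {r} even p<r (tail-down 2+τr≡τp) = ⊥-elim (<⇒≱ p<r (begin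
    r             ≡⟨ sym (τ-involutive r) ⟩
    τ (τ r)       ≡⟨ τ-even (trans (cong parity (trans 2+τr≡τp (τ-even even))) even) ⟩
    τ r           ≤⟨ m≤n+m (τ r) 2 ⟩
    2 + τ r       ≡⟨ trans 2+τr≡τp (τ-even even) ⟩
    p             ∎))
    where open ≤-Reasoning
  tailLink⇒hang-even {p} {r} even p<r (tail-close τp≡1 _) =
    ⊥-elim (ℙₚ.p≢p⁻¹ 0ℙ (trans (sym even) (trans (cong parity (sym (τ-even even))) (cong parity τp≡1))))

  tailLink⇒hang-odd : ∀ {p r} → p < K → parity p ≡ 1ℙ → p < r → TailLink (τ p) (τ r) → Hang p r
  tailLink⇒hang-odd {p} {r} p<K odd p<r (tail-up 2+τp≤K τr≡) = ⊥-elim (<⇒≱ p<r (begin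
    r                     ≡⟨ sym (τ-involutive r) ⟩
    τ (τ r)               ≡⟨ τ-odd (odd⇒<K odd-τr (subst (_≤ K) (sym τr≡) 2+τp≤K)) odd-τr ⟩
    K ∸ τ r               ≤⟨ ∸-monoʳ-≤ K (≤-trans (m≤n+m (τ p) 2) (≤-reflexive (sym τr≡))) ⟩
    K ∸ τ p               ≡⟨ cong (λ x → K ∸ x) (τ-odd p<K odd) ⟩
    K ∸ (K ∸ p)           ≡⟨ m∸[m∸n]≡n (<⇒≤ p<K) ⟩
    p                     ∎))
    where
    open ≤-Reasoning
    odd-τr : parity (τ r) ≡ 1ℙ
    odd-τr = trans (cong parity (trans τr≡ (cong (λ x → 2 + x) (τ-odd p<K odd)))) (trans (parity-K∸ (<⇒≤ p<K)) odd)
  tailLink⇒hang-odd {p} {r} p<K odd p<r (tail-down 2+τr≡τp) =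
    hang-step (≤-trans (m≤n+m (2 + p) (τ r)) (≤-reflexive sum≡K)) (begin
    r                     ≡⟨ sym (τ-involutive r) ⟩
    τ (τ r)               ≡⟨ τ-odd τr<K odd-τr ⟩
    K ∸ τ r               ≡⟨ cong (_∸ τ r) (sym sum≡K) ⟩
    τ r + (2 + p) ∸ τ r   ≡⟨ m+n∸m≡n (τ r) (2 + p) ⟩
    2 + p                 ∎)
    where
    open ≡-Reasoning
    2+τr≡K∸p : 2 + τ r ≡ K ∸ p
    2+τr≡K∸p = trans 2+τr≡τp (τ-odd p<K odd)
    odd-τr : parity (τ r) ≡ 1ℙ
    odd-τr = trans (cong parity 2+τr≡K∸p) (trans (parity-K∸ (<⇒≤ p<K)) odd)
    τr<K : τ r < K
    τr<K = <-≤-trans (≤-trans (m<n+m (τ r) z<s) (≤-reflexive 2+τr≡K∸p)) (m∸n≤m K p)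
    sum≡K : τ r + (2 + p) ≡ K
    sum≡K = begin
      τ r + (2 + p)     ≡⟨ sym (+-assoc (τ r) 2 p) ⟩
      τ r + 2 + p       ≡⟨ cong (_+ p) (+-comm (τ r) 2) ⟩
      2 + τ r + p       ≡⟨ cong (_+ p) 2+τr≡K∸p ⟩
      K ∸ p + p         ≡⟨ m∸n+n≡m (<⇒≤ p<K) ⟩
      K                 ∎
  tailLink⇒hang-odd {p} {r} p<K odd p<r (tail-close τp≡1 1+τr≡n) =
    hang-end 1+p≡K (trans (cong suc (sym τr≡r)) 1+τr≡n)
    where
    τr≡r : τ r ≡ r
    τr≡r = trans (sym (τ-≥ (≤-pred (subst (suc K ≤_) (sym 1+τr≡n) 2k<n)))) (τ-involutive r)
    1+p≡K : 1 + p ≡ K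
    1+p≡K = trans (cong (_+ p) (sym (trans (sym (τ-odd p<K odd)) τp≡1))) (m∸n+n≡m (<⇒≤ p<K))

  kept-τ⇒hang : ∀ {p r} → p < K → p < r → Kept (τ p) (τ r) → Hang p r
  kept-τ⇒hang {p} {r} p<K p<r kept = by-parity (parity p) refl
    where
    link : TailLink (τ p) (τ r)
    link = kept⇒tailLink (τ<K p<K) kept
    by-parity : ∀ ρ → parity p ≡ ρ → Hang p r
    by-parity 0ℙ even = tailLink⇒hang-even even p<r link
    by-parity 1ℙ odd  = tailLink⇒hang-odd p<K odd p<r link

  hang⇒kept-τ : ∀ {p r} → p < K → r < n → Hang p r → Kept (τ p) (τ r)
  hang⇒kept-τ {p} {r} p<K r<n h = tailLink⇒kept (τ<K p<K) (τ<n r<n) (to-link (parity p) refl h)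
    where
    to-link : ∀ ρ → parity p ≡ ρ → Hang p r → TailLink (τ p) (τ r)
    to-link 0ℙ even (hang-step 2+p≤K refl) =
      tail-up (subst (λ x → 2 + x ≤ K) (sym (τ-even even)) 2+p≤K)
              (trans (τ-even even) (cong (λ x → 2 + x) (sym (τ-even even))))
    to-link 0ℙ even (hang-end 1+p≡K _) = ⊥-elim (ℙₚ.p≢p⁻¹ 0ℙ (begin
      0ℙ              ≡⟨ sym parity-K ⟩
      parity K        ≡⟨ cong parity (sym 1+p≡K) ⟩
      parity (1 + p)  ≡⟨ sym (ℙₚ.⁻¹-selfInverse (ℙₚ.suc-homo-⁻¹ p)) ⟩
      parity p ℙ.⁻¹   ≡⟨ cong ℙ._⁻¹ even ⟩
      1ℙ              ∎))
      where open ≡-Reasoning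
    to-link 1ℙ odd (hang-step 2+p≤K refl) = tail-down (begin
      2 + τ (2 + p)       ≡⟨ cong (λ x → 2 + x) (τ-odd (odd⇒<K odd 2+p≤K) odd) ⟩
      2 + (K ∸ (2 + p))   ≡⟨ m+[o∸[m+n]]≡o∸n {2} {p} 2+p≤K ⟩
      K ∸ p               ≡⟨ sym (τ-odd p<K odd) ⟩
      τ p                 ∎)
      where open ≡-Reasoning
    to-link 1ℙ odd (hang-end 1+p≡K 1+r≡n) = tail-close
      (trans (τ-odd p<K odd) (trans (cong (_∸ p) (sym 1+p≡K)) (m+n∸n≡m 1 p)))
      (trans (cong suc (τ-≥ (≤-pred (subst (suc K ≤_) (sym 1+r≡n) 2k<n)))) 1+r≡n)

module StripTailsPositions (n k : ℕ) .{{_ : NonZero n}} (5≤n : 5 ≤ n) (2k<n : 2 * k < n) (j : ℤ) where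

  open Positions n j
  open Classification n k 5≤n 2k<n

  private
    2<n : 2 < n
    2<n = ≤-trans (s≤s (s≤s (s≤s z≤n))) 5≤n

    ≡∸ : ∀ {a p m} → a + p ≡ m → p ≡ m ∸ a
    ≡∸ {a} {p} e = trans (sym (m+n∸m≡n a p)) (cong (_∸ a) e)

    2+[n∸2]≡n : 2 + (n ∸ 2) ≡ n
    2+[n∸2]≡n = m+[n∸m]≡n (<⇒≤ 2<n)

    1≤n : 1 ≤ n
    1≤n = ℕ.>-nonZero⁻¹ n

    1≤K : 1 ≤ k → 1 ≤ K
    1≤K 1≤k = ≤-trans 1≤k (m≤m+n k (k + 0))

    pos-j+1 : pos (j ℤ.+ + 1) ≡ n ∸ 1
    pos-j+1 = trans (pos-j+ 2<n 1) (trans (m<n⇒m%n≡m (≤-reflexive 2+[n∸2]≡n)) (≡∸ {1} 2+[n∸2]≡n))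

    pos-j+2+ : ∀ {s} → s < n → pos (j ℤ.+ + (2 + s)) ≡ s
    pos-j+2+ {s} s<n = begin
      pos (j ℤ.+ + (2 + s))     ≡⟨ pos-j+ 2<n (2 + s) ⟩
      (2 + s + (n ∸ 2)) % n     ≡⟨ cong (_% n) (trans (cong (_+ (n ∸ 2)) (+-comm 2 s)) (+-assoc s 2 (n ∸ 2))) ⟩
      (s + (2 + (n ∸ 2))) % n   ≡⟨ cong (λ x → (s + x) % n) 2+[n∸2]≡n ⟩
      (s + n) % n               ≡⟨ [m+n]%n≡m%n s n ⟩
      s % n                     ≡⟨ m<n⇒m%n≡m s<n ⟩
      s                         ∎
      where open ≡-Reasoning

    pos-last₀ : k ≡ 0 → pos (j ℤ.+ + (2 * k + 1)) ≡ n ∸ 1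
    pos-last₀ refl = pos-j+1

    pos-last : 1 ≤ k → pos (j ℤ.+ + (2 * k + 1)) ≡ K ∸ 1
    pos-last 1≤k = trans (cong (λ t → pos (j ℤ.+ + t)) K+1≡2+[K∸1]) (pos-j+2+ (≤-<-trans (m∸n≤m K 1) 2k<n))
      where
      K+1≡2+[K∸1] : K + 1 ≡ 2 + (K ∸ 1)
      K+1≡2+[K∸1] = trans (+-comm K 1) (cong suc (sym (m+[n∸m]≡n (1≤K 1≤k))))

    link-at : ∀ {q₁ q₂ x y p d} → x ≡ y → p ≡ y → Link n q₁ q₂ p d → Link n q₁ q₂ x d
    link-at x≡y p≡y = subst (λ z → Link n _ _ z _) (trans p≡y (sym x≡y))

  escape⇒ : ∀ {a b} → EscapeRoute n k j a b →
            Σ ℕ λ p → Σ ℕ λ d → Link n (position a) (position b) p d × Escapes d p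
  escape⇒ (inj₁ w) =
    pos j , 2 , pairEdge⇒link j 2 w , window-first (trans (cong (λ x → 2 + x) (pos-j 2<n)) 2+[n∸2]≡n)
  escape⇒ (inj₂ (inj₁ w)) with k ≟ 0
  ... | yes k≡0 = _ , 2 , pairEdge⇒link (j ℤ.+ + (2 * k + 1)) 2 w ,
                  window-last₀ k≡0 (trans (cong suc (pos-last₀ k≡0)) (m+[n∸m]≡n 1≤n))
  ... | no  k≢0 = _ , 2 , pairEdge⇒link (j ℤ.+ + (2 * k + 1)) 2 w ,
                  window-last 1≤k (trans (cong suc (pos-last 1≤k)) (m+[n∸m]≡n (1≤K 1≤k)))
    where
    1≤k : 1 ≤ k
    1≤k = n≢0⇒n>0 k≢0
  escape⇒ (inj₂ (inj₂ (1 , _ , _ , fr))) =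
    _ , 1 , pairEdge⇒link (j ℤ.+ + 1) 1 fr , frame-first (trans (cong suc pos-j+1) (m+[n∸m]≡n 1≤n))
  escape⇒ (inj₂ (inj₂ (suc (suc s) , _ , 2+s≤K+1 , fr))) =
    _ , 1 , pairEdge⇒link (j ℤ.+ + (2 + s)) 1 fr , frame-inner (subst (_< K) (sym (pos-j+2+ (<-trans s<K 2k<n))) s<K)
    where
    s<K : s < K
    s<K = ≤-pred (subst (suc (suc s) ≤_) (+-comm K 1) 2+s≤K+1)

  escape⇐ : ∀ {a b p d} → Link n (position a) (position b) p d → Escapes d p → EscapeRoute n k j a b
  escape⇐ l (frame-first 1+p≡n) =
    inj₂ (inj₂ (1 , ≤-refl , m≤n+m 1 K , link⇒pairEdge (j ℤ.+ + 1) 1 (link-at pos-j+1 (≡∸ 1+p≡n) l)))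
  escape⇐ {p = p} l (frame-inner p<K) =
    inj₂ (inj₂ (2 + p , s≤s z≤n , subst (2 + p ≤_) (+-comm 1 K) (s≤s p<K) ,
                link⇒pairEdge (j ℤ.+ + (2 + p)) 1 (link-at (pos-j+2+ (<-trans p<K 2k<n)) refl l)))
  escape⇐ l (window-first 2+p≡n) =
    inj₁ (link⇒pairEdge j 2 (link-at (pos-j 2<n) (≡∸ 2+p≡n) l))
  escape⇐ l (window-last 1≤k 1+p≡K) =
    inj₂ (inj₁ (link⇒pairEdge (j ℤ.+ + (2 * k + 1)) 2 (link-at (pos-last 1≤k) (≡∸ 1+p≡K) l)))
  escape⇐ l (window-last₀ k≡0 1+p≡n) =
    inj₂ (inj₁ (link⇒pairEdge (j ℤ.+ + (2 * k + 1)) 2 (link-at (pos-last₀ k≡0) (≡∸ 1+p≡n) l)))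

  squareCycle⇒ : ∀ {a b} → SqCycle n a b →
                 Σ ℕ λ p → Σ ℕ λ d → p < n × Gap d × Link n (position a) (position b) p d
  squareCycle⇒ (i , inj₁ fr) = pos i , 1 , pos<n i , frame , pairEdge⇒link i 1 fr
  squareCycle⇒ (i , inj₂ w)  = pos i , 2 , pos<n i , window , pairEdge⇒link i 2 w

  squareCycle⇐ : ∀ {a b p d} → p < n → Gap d → Link n (position a) (position b) p d → SqCycle n a b
  squareCycle⇐ {p = p} p<n frame  l = i , inj₁ (link⇒pairEdge i 1 (link-at (pos-j+2+ p<n) refl l))
    where
    i : ℤ
    i = j ℤ.+ + (2 + p)
  squareCycle⇐ {p = p} p<n window l = i , inj₂ (link⇒pairEdge i 2 (link-at (pos-j+2+ p<n) refl l))
    where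
    i : ℤ
    i = j ℤ.+ + (2 + p)

  stripTails⇒kept : ∀ {a b} → StripTails n k j a b → Kept (position a) (position b)
  stripTails⇒kept (sq , ¬escape) with squareCycle⇒ sq
  ... | p , d , p<n , g , l with survives⊎escapes p<n g
  ...   | inj₁ s = p , d , p<n , l , s
  ...   | inj₂ e = ⊥-elim (¬escape (escape⇐ l e))

  kept⇒stripTails : ∀ {a b} → Kept (position a) (position b) → StripTails n k j a b
  kept⇒stripTails (p , d , p<n , l , s) = squareCycle⇐ p<n (survives⇒gap s) l , not-escape
    where
    not-escape : ¬ EscapeRoute n k j _ _
    not-escape esc with escape⇒ esc
    ... | p′ , d′ , l′ , e with link-unique (survives⇒gap s) (escapes⇒gap e) l l′
    ...   | refl , refl = survives⇒¬escapes s e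

-- Growing the strip graph with tails from the strip, one leaf at a time

m>n⇒m∸n≡1+[m∸1+n] : ∀ {m n} → n < m → m ∸ n ≡ suc (m ∸ suc n)
m>n⇒m∸n≡1+[m∸1+n] {suc m} {zero}  _         = refl
m>n⇒m∸n≡1+[m∸1+n] {suc m} {suc n} (s≤s n<m) = m>n⇒m∸n≡1+[m∸1+n] n<m

module Stages (n k : ℕ) .{{_ : NonZero n}} (5≤n : 5 ≤ n) (2k<n : 2 * k < n) where

  open Classification n k 5≤n 2k<n

  m : ℕ
  m = n ∸ K

  K+m≡n : K + m ≡ n
  K+m≡n = m+[n∸m]≡n (<⇒≤ 2k<n)

  -- the graph induced by Kept ∘ τ on the tail-ordered positions K − s, …, n − 1
  Stage : (s : ℕ) → Graph (s + m)
  Stage s x y = Kept (τ (K ∸ s + toℕ x)) (τ (K ∸ s + toℕ y))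

  stage-position<n : ∀ {s} → s ≤ K → (x : Fin (s + m)) → K ∸ s + toℕ x < n
  stage-position<n {s} s≤K x = subst (K ∸ s + toℕ x <_) total (+-monoʳ-< (K ∸ s) (toℕ<n x))
    where
    total : K ∸ s + (s + m) ≡ n
    total = trans (sym (+-assoc (K ∸ s) s m)) (trans (cong (_+ m) (m∸n+n≡m s≤K)) K+m≡n)

  numSpanningTrees-stage₀ : ∀ {c} → NumSpanningTrees (Strip m) c → NumSpanningTrees (Stage 0) c
  numSpanningTrees-stage₀ = numSpanningTrees-cong
    (λ x y _ adj → subst₂ Kept (sym (τ-K+ x)) (sym (τ-K+ y))
      (adjacent⇒kept (m≤m+n K _) (m≤m+n K _) (stage-position<n z≤n x) (stage-position<n z≤n y) (adjacent-+ˡ K adj)))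
    (λ x y _ kept → adjacent-+ˡ⁻ K (kept⇒adjacent (m≤m+n K _) (m≤m+n K _) (subst₂ Kept (τ-K+ x) (τ-K+ y) kept)))
    where
    τ-K+ : (x : Fin m) → τ (K + toℕ x) ≡ K + toℕ x
    τ-K+ x = τ-≥ (m≤m+n K (toℕ x))

  1≤m : 1 ≤ m
  1≤m = +-cancelˡ-≤ K 1 m (subst₂ _≤_ (+-comm 1 K) (sym K+m≡n) 2k<n)

  -- the vertex of Stage s to which the next leaf is attached: the end n − 1 of the strip
  -- for the first leaf, and otherwise the leaf added two steps earlier
  anchorℕ : ℕ → ℕ
  anchorℕ zero    = m ∸ 1
  anchorℕ (suc _) = 1

  anchorℕ< : ∀ s → anchorℕ s < s + m
  anchorℕ< zero    = ∸-monoʳ-< {m} {1} {0} z<s 1≤m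
  anchorℕ< (suc s) = s≤s (≤-trans 1≤m (m≤n+m m s))

  anchor : ∀ s → Fin (s + m)
  anchor s = fromℕ< (anchorℕ< s)

  toℕ-anchor : ∀ s → toℕ (anchor s) ≡ anchorℕ s
  toℕ-anchor s = toℕ-fromℕ< (anchorℕ< s)

  hang⇒anchor : ∀ {s} → s < K → ∀ b → Hang (K ∸ suc s) (K ∸ suc s + suc b) → b ≡ anchorℕ s
  hang⇒anchor {zero} 0<K b (hang-step 2+o≤K _) =
    ⊥-elim (<-irrefl refl (subst (2 + (K ∸ 1) ≤_) (m>n⇒m∸n≡1+[m∸1+n] 0<K) 2+o≤K))
  hang⇒anchor {zero} 0<K b (hang-end _ 1+r≡n) = cong ℕ.pred (+-cancelˡ-≡ K _ _ (begin
    K + suc b               ≡⟨ cong (_+ suc b) (m>n⇒m∸n≡1+[m∸1+n] 0<K) ⟩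
    1 + (K ∸ 1) + suc b     ≡⟨ 1+r≡n ⟩
    n                       ≡⟨ sym K+m≡n ⟩
    K + m                   ∎))
    where open ≡-Reasoning
  hang⇒anchor {suc s} _ b (hang-step _ r≡2+o) =
    cong ℕ.pred (+-cancelˡ-≡ (K ∸ suc (suc s)) _ _ (trans r≡2+o (+-comm 2 _)))
  hang⇒anchor {suc s} s<K b (hang-end 1+o≡K _) = ⊥-elim (1+n≢0 (+-cancelˡ-≡ (1 + o) _ _ (begin
    1 + o + suc s         ≡⟨ cong (_+ suc s) (sym (m>n⇒m∸n≡1+[m∸1+n] s<K)) ⟩
    K ∸ suc s + suc s     ≡⟨ m∸n+n≡m (<⇒≤ s<K) ⟩
    K                     ≡⟨ sym 1+o≡K ⟩
    1 + o                 ≡⟨ sym (+-identityʳ (1 + o)) ⟩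
    1 + o + 0             ∎)))
    where
    open ≡-Reasoning
    o : ℕ
    o = K ∸ suc (suc s)

  anchor⇒hang : ∀ {s} → s < K → ∀ b → b ≡ anchorℕ s → Hang (K ∸ suc s) (K ∸ suc s + suc b)
  anchor⇒hang {zero} 0<K b refl = hang-end (sym K≡1+o) (begin
    1 + (K ∸ 1 + suc (m ∸ 1))   ≡⟨ cong (_+ suc (m ∸ 1)) (sym K≡1+o) ⟩
    K + suc (m ∸ 1)             ≡⟨ cong (λ x → K + x) (m+[n∸m]≡n 1≤m) ⟩
    K + m                       ≡⟨ K+m≡n ⟩
    n                           ∎)
    where
    open ≡-Reasoning
    K≡1+o : K ≡ 1 + (K ∸ 1)
    K≡1+o = m>n⇒m∸n≡1+[m∸1+n] 0<K
  anchor⇒hang {suc s} s<K b refl = hang-step 2+o≤K (+-comm (K ∸ suc (suc s)) 2)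
    where
    2+o≤K : 2 + (K ∸ suc (suc s)) ≤ K
    2+o≤K = begin
      2 + (K ∸ suc (suc s))       ≤⟨ s≤s (s≤s (m≤m+n _ s)) ⟩
      2 + (K ∸ suc (suc s) + s)   ≡⟨ cong suc (sym (+-suc _ s)) ⟩
      1 + (K ∸ suc (suc s)) + suc s ≡⟨ cong (_+ suc s) (sym (m>n⇒m∸n≡1+[m∸1+n] s<K)) ⟩
      K ∸ suc s + suc s           ≡⟨ m∸n+n≡m (<⇒≤ s<K) ⟩
      K                           ∎
      where open ≤-Reasoning

  numSpanningTrees-stage-suc : ∀ {s} → s < K → ∀ {c} →
                               NumSpanningTrees (Stage s) c → NumSpanningTrees (Stage (suc s)) c
  numSpanningTrees-stage-suc {s} s<K t =
    numSpanningTrees-cong leaf⇒stage stage⇒leaf (numSpanningTrees-addLeaf (Stage s) (anchor s) t)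
    where
    o : ℕ
    o = K ∸ suc s
    o<K : o < K
    o<K = ∸-monoʳ-< z<s s<K
    shift : ∀ a → o + suc a ≡ K ∸ s + a
    shift a = trans (+-suc o a) (cong (_+ a) (sym (m>n⇒m∸n≡1+[m∸1+n] s<K)))
    at-leaf : Kept (τ (o + 0)) ≡ Kept (τ o)
    at-leaf = cong (λ x → Kept (τ x)) (+-identityʳ o)
    leaf-edge⇒ : ∀ b → b ≡ anchor s → Stage (suc s) zero (suc b)
    leaf-edge⇒ b b≡ = subst (λ P → P (τ (o + suc (toℕ b)))) (sym at-leaf)
      (hang⇒kept-τ o<K (stage-position<n s<K (suc b))
        (anchor⇒hang s<K (toℕ b) (trans (cong toℕ b≡) (toℕ-anchor s))))
    leaf-edge⇐ : ∀ b → Stage (suc s) zero (suc b) → b ≡ anchor s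
    leaf-edge⇐ b kept = toℕ-injective (trans
      (hang⇒anchor s<K (toℕ b) (kept-τ⇒hang o<K (m<m+n o z<s) (subst (λ P → P (τ (o + suc (toℕ b)))) at-leaf kept)))
      (sym (toℕ-anchor s)))
    leaf⇒stage : ∀ x y → x ≢ y → AddLeaf (Stage s) (anchor s) x y → Stage (suc s) x y
    leaf⇒stage zero    zero    0≢0 _    = ⊥-elim (0≢0 refl)
    leaf⇒stage zero    (suc b) _   b≡   = leaf-edge⇒ b b≡
    leaf⇒stage (suc a) zero    _   a≡   = kept-sym (leaf-edge⇒ a a≡)
    leaf⇒stage (suc a) (suc b) _   kept =
      subst₂ (λ x y → Kept (τ x) (τ y)) (sym (shift (toℕ a))) (sym (shift (toℕ b))) kept
    stage⇒leaf : ∀ x y → x ≢ y → Stage (suc s) x y → AddLeaf (Stage s) (anchor s) x y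
    stage⇒leaf zero    zero    0≢0 _    = 0≢0 refl
    stage⇒leaf zero    (suc b) _   kept = leaf-edge⇐ b kept
    stage⇒leaf (suc a) zero    _   kept = leaf-edge⇐ a (kept-sym kept)
    stage⇒leaf (suc a) (suc b) _   kept =
      subst₂ (λ x y → Kept (τ x) (τ y)) (shift (toℕ a)) (shift (toℕ b)) kept

  numSpanningTrees-stage : ∀ {s} → s ≤ K → ∀ {c} → NumSpanningTrees (Strip m) c → NumSpanningTrees (Stage s) c
  numSpanningTrees-stage {zero}  _     t = numSpanningTrees-stage₀ t
  numSpanningTrees-stage {suc s} 1+s≤K t = numSpanningTrees-stage-suc 1+s≤K (numSpanningTrees-stage (<⇒≤ 1+s≤K) t)

module Relabelling (n k : ℕ) .{{_ : NonZero n}} (5≤n : 5 ≤ n) (2k<n : 2 * k < n) (j : ℤ) where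

  open Positions n j
  open Classification n k 5≤n 2k<n
  open StripTailsPositions n k 5≤n 2k<n j
  open Stages n k 5≤n 2k<n

  private
    <K+m : ∀ {x} → x < n → x < K + m
    <K+m = subst (_ <_) (sym K+m≡n)

  σ : Fin n → Fin (K + m)
  σ a = fromℕ< (<K+m (τ<n (pos<n (+ toℕ a))))

  ρ : Fin (K + m) → Fin n
  ρ x = vertex (τ (toℕ x))

  τ-stage-σ : ∀ a → τ (K ∸ K + toℕ (σ a)) ≡ position a
  τ-stage-σ a = trans (cong τ (trans (cong (_+ toℕ (σ a)) (n∸n≡0 K)) (toℕ-fromℕ< _))) (τ-involutive (position a))

  ρ∘σ : ∀ a → ρ (σ a) ≡ a
  ρ∘σ a = trans (cong (λ x → vertex (τ x)) (toℕ-fromℕ< _)) (trans (cong vertex (τ-involutive (position a))) (vertex-position a))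

  σ∘ρ : ∀ x → σ (ρ x) ≡ x
  σ∘ρ x = toℕ-injective (begin
    toℕ (σ (ρ x))                    ≡⟨ toℕ-fromℕ< _ ⟩
    τ (position (vertex (τ (toℕ x)))) ≡⟨ cong τ (position-vertex (τ<n (subst (toℕ x <_) K+m≡n (toℕ<n x)))) ⟩
    τ (τ (toℕ x))                    ≡⟨ τ-involutive (toℕ x) ⟩
    toℕ x                            ∎)
    where open ≡-Reasoning

  numSpanningTrees-stripTails : ∀ {c} → NumSpanningTrees (Stage K) c → NumSpanningTrees (StripTails n k j) c
  numSpanningTrees-stripTails = numSpanningTrees-relabel σ ρ ρ∘σ σ∘ρ
    (λ a b _ kept → kept⇒stripTails (subst₂ Kept (τ-stage-σ a) (τ-stage-σ b) kept))
    (λ a b _ st → subst₂ Kept (sym (τ-stage-σ a)) (sym (τ-stage-σ b)) (stripTails⇒kept st))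

k≤⌈n∸2/2⌉⇒2k<n : ∀ {n k} → 5 ≤ n → k ≤ ⌈ n ∸ 2 /2⌉ → 2 * k < n
k≤⌈n∸2/2⌉⇒2k<n {n} {k} 5≤n k≤ = begin-strict
  2 * k                            ≤⟨ *-monoʳ-≤ 2 k≤ ⟩
  h + (h + 0)                      ≡⟨ cong (λ x → h + x) (+-identityʳ h) ⟩
  h + h                            ≤⟨ +-monoʳ-≤ h (⌊n/2⌋≤⌈n/2⌉ (suc (n ∸ 2))) ⟩
  h + ⌈ suc (n ∸ 2) /2⌉            ≡⟨ ⌊n/2⌋+⌈n/2⌉≡n (suc (n ∸ 2)) ⟩
  suc (n ∸ 2)                      <⟨ n<1+n _ ⟩
  2 + (n ∸ 2)                      ≡⟨ m+[n∸m]≡n (≤-trans (s≤s (s≤s z≤n)) 5≤n) ⟩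
  n                                ∎
  where
  open ≤-Reasoning
  h : ℕ
  h = ⌈ n ∸ 2 /2⌉

lemma2p8 : (n : ℕ) .{{_ : NonZero n}} → 5 ≤ n → (k : ℕ) → (j : ℤ) →
    k ≤ ⌈ n ∸ 2 /2⌉ →
    Σ ℕ λ c → NumSpanningTrees (StripTails n k j) c × NumSpanningTrees (Strip (n ∸ 2 * k)) c
lemma2p8 n 5≤n k j k≤ = c , numSpanningTrees-stripTails (numSpanningTrees-stage ≤-refl strip-trees) , strip-trees
  where
  open Stages n k 5≤n (k≤⌈n∸2/2⌉⇒2k<n 5≤n k≤)
  open Relabelling n k 5≤n (k≤⌈n∸2/2⌉⇒2k<n 5≤n k≤) j
  count : Σ ℕ (NumSpanningTrees (Strip m))
  count = numSpanningTrees-exists (Strip m) (λ a b → adjacent? (toℕ a) (toℕ b))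
  c : ℕ
  c = proj₁ count
  strip-trees : NumSpanningTrees (Strip m) c
  strip-trees = proj₂ count
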